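{- Let $k\ge 2$ and $p_k(x;a,b)=1-ax-bx^k$. Then \[ H_k(x)=\frac{1}{1-V_k(x)}=\frac{1}{p_k(x;a,b^k)}*\frac{1}{p_k(x;a,b^k)}, \] where $*$ denotes the Hadamard product.
   Context: Consider tilings of the $2k\times n$ rectangle $[0,n]\times[0,2k]$ (height $2k$, width $n$) by $k\times 1$ tiles (vertical tiles cover $k$ consecutive cells of a column, horizontal tiles $k$ consecutive cells of a row); a tiling has weight $a^vb^h$ where $v,h$ are the numbers of vertical and horizontal tiles. A tiling has a horizontal fault at $y=c$ ($0<c<2k$) if no tile interior meets the line $y=c$, and a vertical fault at $x=c$ ($0<c<n$) if no tile interior meets the line $x=c$; it is vertically fault-free if it has no vertical fault. Let $h_{k,n}$ be the total weight of tilings of the $2k\times n$ rectangle with a horizontal fault at $y=k$ ($h_{k,0}=1$), and $v_{k,n}$ the total weight of vertically fault-free such tilings. Put $H_k(x)=\sum_{n\ge0}h_{k,n}x^n$ and $V_k(x)=\sum_{n\ge1}v_{k,n}x^n$. The Hadamard product of $\sum a_nx^n$ and $\sum b_nx^n$ is $\sum a_nb_nx^n$. -}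

module Defs where

open import Data.Nat using (ℕ; zero; suc; _+_; _∸_; _<ᵇ_; _≤ᵇ_; _≡ᵇ_)
open import Data.Bool using (Bool; true; false; _∧_; _∨_; not; if_then_else_)
open import Data.List using (List; []; _∷_; _++_; map; upTo; concatMap; foldr)
open import Data.Bool.ListAction using (all; any)
open import Algebra.Bundles using (CommutativeRing)
open import Relation.Binary.PropositionalEquality using (_≡_)

-- Tiles in the 2k × n rectangle [0,n] × [0,2k] (x = column, y = row).
-- vert x y  : vertical k×1 tile occupying the box [x,x+1] × [y,y+k]
-- horiz x y : horizontal k×1 tile occupying the box [x,x+k] × [y,y+1]

data Tile : Set where
  vert  : ℕ → ℕ → Tile
  horiz : ℕ → ℕ → Tile

isVert : Tile → Bool
isVert (vert _ _)  = true
isVert (horiz _ _) = false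

record Box : Set where
  constructor box
  field
    x0 x1 y0 y1 : ℕ

tileBox : ℕ → Tile → Box
tileBox k (vert x y)  = box x (suc x) y (y + k)
tileBox k (horiz x y) = box x (x + k) y (suc y)

covers : ℕ → ℕ → ℕ → Tile → Bool
covers k i j t with tileBox k t
... | box x0 x1 y0 y1 = (x0 ≤ᵇ i) ∧ (i <ᵇ x1) ∧ (y0 ≤ᵇ j) ∧ (j <ᵇ y1)

meetsVLine : ℕ → ℕ → Tile → Bool
meetsVLine k c t with tileBox k t
... | box x0 x1 y0 y1 = (x0 <ᵇ c) ∧ (c <ᵇ x1)

meetsHLine : ℕ → ℕ → Tile → Bool
meetsHLine k c t with tileBox k t
... | box x0 x1 y0 y1 = (y0 <ᵇ c) ∧ (c <ᵇ y1)

inside : ℕ → ℕ → Tile → Bool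
inside k n t with tileBox k t
... | box x0 x1 y0 y1 = (x1 ≤ᵇ n) ∧ (y1 ≤ᵇ (k + k))

filterᵇ : {A : Set} → (A → Bool) → List A → List A
filterᵇ p []       = []
filterᵇ p (x ∷ xs) = if p x then x ∷ filterᵇ p xs else filterᵇ p xs

placements : ℕ → ℕ → List Tile
placements k n =
  filterᵇ (inside k n)
    (concatMap (λ x → concatMap (λ y → vert x y ∷ horiz x y ∷ []) (upTo (k + k))) (upTo n))

-- all sublists (= all subsets of a duplicate-free list)
sublists : {A : Set} → List A → List (List A)
sublists []       = [] ∷ []
sublists (x ∷ xs) = map (x ∷_) (sublists xs) ++ sublists xs

count : {A : Set} → (A → Bool) → List A → ℕ
count p xs = foldr (λ x r → if p x then suc r else r) 0 xs

isTiling : ℕ → ℕ → List Tile → Bool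
isTiling k n ts =
  all (λ i → all (λ j → count (covers k i j) ts ≡ᵇ 1) (upTo (k + k))) (upTo n)

hFault : ℕ → ℕ → List Tile → Bool
hFault k c ts = not (any (meetsHLine k c) ts)

vFault : ℕ → ℕ → List Tile → Bool
vFault k c ts = not (any (meetsVLine k c) ts)

vFaultFree : ℕ → ℕ → List Tile → Bool
vFaultFree k n ts = all (λ c → (0 <ᵇ c) ⇒ not (vFault k c ts)) (upTo n)
  where
  _⇒_ : Bool → Bool → Bool
  p ⇒ q = not p ∨ q

hTilings : ℕ → ℕ → List (List Tile)
hTilings k n = filterᵇ (λ ts → isTiling k n ts ∧ hFault k k ts) (sublists (placements k n))

vTilings : ℕ → ℕ → List (List Tile)
vTilings k n = filterᵇ (λ ts → isTiling k n ts ∧ hFault k k ts ∧ vFaultFree k n ts) (sublists (placements k n))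

module WithRing {c ℓ} (R : CommutativeRing c ℓ) where
  open CommutativeRing R renaming (_+_ to _+ᴿ_; _*_ to _*ᴿ_)

  pow : Carrier → ℕ → Carrier
  pow x zero    = 1#
  pow x (suc m) = x *ᴿ pow x m

  weight : Carrier → Carrier → ℕ → List Tile → Carrier
  weight a b k ts = pow a (count isVert ts) *ᴿ pow b (count (λ t → not (isVert t)) ts)

  totalWeight : Carrier → Carrier → ℕ → List (List Tile) → Carrier
  totalWeight a b k tss = foldr (λ ts r → weight a b k ts +ᴿ r) 0# tss

  h : Carrier → Carrier → ℕ → ℕ → Carrier
  h a b k n = totalWeight a b k (hTilings k n)

  v : Carrier → Carrier → ℕ → ℕ → Carrier
  v a b k n = totalWeight a b k (vTilings k n)

  Series : Set c
  Series = ℕ → Carrier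

  _≈ₛ_ : Series → Series → Set ℓ
  f ≈ₛ g = ∀ n → f n ≈ g n

  sumTo : ℕ → (ℕ → Carrier) → Carrier
  sumTo zero    f = 0#
  sumTo (suc m) f = sumTo m f +ᴿ f m

  mono : Carrier → ℕ → Series
  mono c m n = if n ≡ᵇ m then c else 0#

  oneₛ : Series
  oneₛ = mono 1# 0

  _−ₛ_ : Series → Series → Series
  (f −ₛ g) n = f n - g n

  _⊛_ : Series → Series → Series
  (f ⊛ g) n = sumTo (suc n) (λ i → f i *ᴿ g (n ∸ i))

  _⊙_ : Series → Series → Series
  (f ⊙ g) n = f n *ᴿ g n

  H : Carrier → Carrier → ℕ → Series
  H a b k n = h a b k n

  V : Carrier → Carrier → ℕ → Series
  V a b k zero    = 0#
  V a b k (suc n) = v a b k (suc n)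

  p : ℕ → Carrier → Carrier → Series
  p k a b = (oneₛ −ₛ mono a 1) −ₛ mono b k

-- A horizontal fault at y = k cuts a tiling into independent tilings of the two k × n strips, so h_n = g_n²,
-- where g_n is the weight of the tilings of a k × n strip. Column 0 of a strip is covered either by one
-- vertical tile or by a stack of k horizontal ones, whence g_{n+1} = a g_n + b^k g_{n+1-k}: g is the
-- coefficient sequence of 1/p_k(x; a, b^k). Cutting a tiling at its leftmost vertical fault (the right edge
-- always is one) gives h_n = Σ_{c=1}^{n} v_c h_{n-c} for n ≥ 1, that is H = 1 + H V.
-- Sums over tilings are sums over all sublists of the list of placements, weighted by the 0/1 value of the
-- tiling conditions; a placement whose presence forces that value to 0 can be dropped from the list.

module Submission where

open import Defs
open import Algebra.Bundles using (CommutativeRing; Semiring)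
import Algebra.Properties.CommutativeSemigroup as CommSemigroupProperties
import Algebra.Properties.Ring as RingProperties
open import Data.Bool using (Bool; true; false; _∧_; _∨_; not; if_then_else_)
open import Data.Bool.Properties using (∧-identityʳ; ∧-zeroʳ; ∧-comm; ∧-conicalˡ; ∧-conicalʳ; ∨-identityʳ; not-injective; T-≡)
open import Data.Bool.ListAction using (all; any)
open import Data.List using (List; []; _∷_; _++_; map; upTo; concatMap; foldr; length)
open import Data.List.Properties using (map-++; map-∘; concatMap-++; ++-identityʳ; ++-assoc; upTo-∷ʳ; map-concatMap; concatMap-map; concatMap-cong; length-++)
open import Data.List.Relation.Unary.All as All using (All; []; _∷_; universal)
open import Data.List.Relation.Unary.All.Properties using (++⁺; map⁺; gmap⁺; concat⁺; all-upTo)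
open import Data.Nat using (ℕ; zero; suc; _+_; _∸_; _<ᵇ_; _≤ᵇ_; _≡ᵇ_; _≤_; _<_; _≤?_; _<?_; _≟_; z≤n; s≤s)
import Data.Nat.Properties as ℕₚ
open import Data.Product using (Σ; _×_; _,_; proj₁; proj₂)
open import Data.Sum using (inj₁; inj₂)
open import Data.Empty using (⊥-elim)
open import Function using (_∘_; case_of_)
open import Function.Bundles using (Equivalence)
open import Relation.Binary.Definitions using (tri<; tri≈; tri>)
import Relation.Binary.PropositionalEquality as ≡
open ≡ using (_≡_; _≢_)
open import Relation.Nullary.Decidable using (dec-true; dec-false)

module BoolListLemmas where
  open ≡
  open ℕₚ

  ≤ᵇ-true : ∀ {m n} → m ≤ n → (m ≤ᵇ n) ≡ true
  ≤ᵇ-true {m} {n} = dec-true (m ≤? n)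

  ≤ᵇ-false : ∀ {m n} → n < m → (m ≤ᵇ n) ≡ false
  ≤ᵇ-false {m} {n} n<m = dec-false (m ≤? n) (<⇒≱ n<m)

  <ᵇ-true : ∀ {m n} → m < n → (m <ᵇ n) ≡ true
  <ᵇ-true {m} {n} = dec-true (m <? n)

  <ᵇ-false : ∀ {m n} → n ≤ m → (m <ᵇ n) ≡ false
  <ᵇ-false {m} {n} n≤m = dec-false (m <? n) (≤⇒≯ n≤m)

  ≤ᵇ-true⇒≤ : ∀ {m n} → (m ≤ᵇ n) ≡ true → m ≤ n
  ≤ᵇ-true⇒≤ {m} {n} e = ≤ᵇ⇒≤ m n (Equivalence.from T-≡ e)

  ≤ᵇ-false⇒> : ∀ {m n} → (m ≤ᵇ n) ≡ false → n < m
  ≤ᵇ-false⇒> e = ≰⇒> (λ m≤n → contra (trans (sym (≤ᵇ-true m≤n)) e))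
    where
    contra : true ≢ false
    contra ()

  <ᵇ-suc : ∀ m n → (m <ᵇ suc n) ≡ (m ≤ᵇ n)
  <ᵇ-suc zero    n = refl
  <ᵇ-suc (suc m) n = refl

  <ᵇ-+ˡ : ∀ c m n → (c + m <ᵇ c + n) ≡ (m <ᵇ n)
  <ᵇ-+ˡ zero    m n = refl
  <ᵇ-+ˡ (suc c) m n = <ᵇ-+ˡ c m n

  ≤ᵇ-+ˡ : ∀ c m n → (c + m ≤ᵇ c + n) ≡ (m ≤ᵇ n)
  ≤ᵇ-+ˡ zero    m n = refl
  ≤ᵇ-+ˡ (suc c) m n = trans (<ᵇ-suc (c + m) (c + n)) (≤ᵇ-+ˡ c m n)

  ≡ᵇ-refl : ∀ m → (m ≡ᵇ m) ≡ true
  ≡ᵇ-refl m = dec-true (m ≟ m) refl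

  ≡ᵇ-false : ∀ {m n} → m ≢ n → (m ≡ᵇ n) ≡ false
  ≡ᵇ-false {m} {n} = dec-false (m ≟ n)

  ≡ᵇ1-false : ∀ {m} → 2 ≤ m → (m ≡ᵇ 1) ≡ false
  ≡ᵇ1-false {suc (suc m)} _         = refl
  ≡ᵇ1-false {suc zero}    (s≤s ())

  module _ {A : Set} where

    filterᵇ-accept : (p : A → Bool) {x : A} (xs : List A) → p x ≡ true → filterᵇ p (x ∷ xs) ≡ x ∷ filterᵇ p xs
    filterᵇ-accept p xs e rewrite e = refl

    filterᵇ-reject : (p : A → Bool) {x : A} (xs : List A) → p x ≡ false → filterᵇ p (x ∷ xs) ≡ filterᵇ p xs
    filterᵇ-reject p xs e rewrite e = refl

    filterᵇ-++ : (p : A → Bool) (xs ys : List A) → filterᵇ p (xs ++ ys) ≡ filterᵇ p xs ++ filterᵇ p ys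
    filterᵇ-++ p []       ys = refl
    filterᵇ-++ p (x ∷ xs) ys with p x
    ... | true  = cong (x ∷_) (filterᵇ-++ p xs ys)
    ... | false = filterᵇ-++ p xs ys

    filterᵇ-filterᵇ : (p q : A → Bool) (xs : List A) → filterᵇ p (filterᵇ q xs) ≡ filterᵇ (λ x → q x ∧ p x) xs
    filterᵇ-filterᵇ p q []       = refl
    filterᵇ-filterᵇ p q (x ∷ xs) with q x
    ... | false = filterᵇ-filterᵇ p q xs
    ... | true with p x
    ...   | true  = cong (x ∷_) (filterᵇ-filterᵇ p q xs)
    ...   | false = filterᵇ-filterᵇ p q xs

    filterᵇ-cong : {p q : A → Bool} (xs : List A) → (∀ x → p x ≡ q x) → filterᵇ p xs ≡ filterᵇ q xs
    filterᵇ-cong [] e = refl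
    filterᵇ-cong {p} {q} (x ∷ xs) e rewrite e x with q x
    ... | true  = cong (x ∷_) (filterᵇ-cong xs e)
    ... | false = filterᵇ-cong xs e

    filterᵇ-comm : (p q : A → Bool) (xs : List A) → filterᵇ p (filterᵇ q xs) ≡ filterᵇ q (filterᵇ p xs)
    filterᵇ-comm p q xs =
      trans (filterᵇ-filterᵇ p q xs) (trans (filterᵇ-cong xs (λ x → ∧-comm (q x) (p x))) (sym (filterᵇ-filterᵇ q p xs)))

    filterᵇ-none : {p : A → Bool} {xs : List A} → All (λ x → p x ≡ false) xs → filterᵇ p xs ≡ []
    filterᵇ-none []                     = refl
    filterᵇ-none {p} {x ∷ xs} (e ∷ es) rewrite e = filterᵇ-none es

    filterᵇ-all : {p : A → Bool} {xs : List A} → All (λ x → p x ≡ true) xs → filterᵇ p xs ≡ xs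
    filterᵇ-all []                     = refl
    filterᵇ-all {p} {x ∷ xs} (e ∷ es) rewrite e = cong (x ∷_) (filterᵇ-all es)

    All-filterᵇ : (p : A → Bool) (xs : List A) → All (λ x → p x ≡ true) (filterᵇ p xs)
    All-filterᵇ p []       = []
    All-filterᵇ p (x ∷ xs) with p x in e
    ... | true  = e ∷ All-filterᵇ p xs
    ... | false = All-filterᵇ p xs

    All-filterᵇ⁺ : {P : A → Set} (p : A → Bool) {xs : List A} → All P xs → All P (filterᵇ p xs)
    All-filterᵇ⁺ p []                    = []
    All-filterᵇ⁺ p {x ∷ xs} (px ∷ pxs) with p x
    ... | true  = px ∷ All-filterᵇ⁺ p pxs
    ... | false = All-filterᵇ⁺ p pxs

    All-filterᵇ-× : {P : A → Set} (p : A → Bool) {xs : List A} → All P xs → All (λ x → p x ≡ true × P x) (filterᵇ p xs)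
    All-filterᵇ-× p {xs} pxs = All.zip (All-filterᵇ p xs , All-filterᵇ⁺ p pxs)

    count-++ : (p : A → Bool) (xs ys : List A) → count p (xs ++ ys) ≡ count p xs + count p ys
    count-++ p []       ys = refl
    count-++ p (x ∷ xs) ys with p x
    ... | true  = cong suc (count-++ p xs ys)
    ... | false = count-++ p xs ys

    count-partition : (p q : A → Bool) (xs : List A) →
                      count p xs ≡ count p (filterᵇ q xs) + count p (filterᵇ (not ∘ q) xs)
    count-partition p q []       = refl
    count-partition p q (x ∷ xs) with q x
    ... | true with p x
    ...   | true  = cong suc (count-partition p q xs)
    ...   | false = count-partition p q xs
    count-partition p q (x ∷ xs) | false with p x
    ...   | true  = trans (cong suc (count-partition p q xs)) (sym (+-suc _ _))
    ...   | false = count-partition p q xs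

    count-cong : {p q : A → Bool} (xs : List A) → (∀ x → p x ≡ q x) → count p xs ≡ count q xs
    count-cong [] e = refl
    count-cong {p} {q} (x ∷ xs) e rewrite e x with q x
    ... | true  = cong suc (count-cong xs e)
    ... | false = count-cong xs e

    count-none : {p : A → Bool} {xs : List A} → All (λ x → p x ≡ false) xs → count p xs ≡ 0
    count-none []                     = refl
    count-none {p} {x ∷ xs} (e ∷ es) rewrite e = count-none es

    count-all : {p : A → Bool} {xs : List A} → All (λ x → p x ≡ true) xs → count p xs ≡ length xs
    count-all []                     = refl
    count-all {p} {x ∷ xs} (e ∷ es) rewrite e = cong suc (count-all es)

    count-++-∷-≥1 : (p : A → Bool) (xs : List A) (x : A) (ys : List A) → p x ≡ true → 1 ≤ count p (xs ++ x ∷ ys)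
    count-++-∷-≥1 p xs x ys e rewrite count-++ p xs (x ∷ ys) | e = ≤-trans (s≤s z≤n) (≤-reflexive (sym (+-suc _ _)))

    count-++-∷-∷-≥2 : (p : A → Bool) (xs : List A) (x y : A) (ys : List A) → p x ≡ true → p y ≡ true →
                      2 ≤ count p (xs ++ x ∷ y ∷ ys)
    count-++-∷-∷-≥2 p xs x y ys px py rewrite count-++ p xs (x ∷ y ∷ ys) | px | py =
      ≤-trans (s≤s (s≤s z≤n)) (≤-reflexive (sym (trans (+-suc _ _) (cong suc (+-suc _ _)))))

    any-++ : (p : A → Bool) (xs ys : List A) → any p (xs ++ ys) ≡ any p xs ∨ any p ys
    any-++ p []       ys = refl
    any-++ p (x ∷ xs) ys rewrite any-++ p xs ys with p x
    ... | true  = refl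
    ... | false = refl

    any≡count≢0 : (p : A → Bool) (xs : List A) → any p xs ≡ not (count p xs ≡ᵇ 0)
    any≡count≢0 p []       = refl
    any≡count≢0 p (x ∷ xs) with p x
    ... | true  = refl
    ... | false = any≡count≢0 p xs

    any-none : {p : A → Bool} {xs : List A} → All (λ x → p x ≡ false) xs → any p xs ≡ false
    any-none {p} {xs} es = trans (any≡count≢0 p xs) (cong (λ m → not (m ≡ᵇ 0)) (count-none es))

    any-++-∷ : (p : A → Bool) (xs : List A) (x : A) (ys : List A) → p x ≡ true → any p (xs ++ x ∷ ys) ≡ true
    any-++-∷ p xs x ys e rewrite any-++ p xs (x ∷ ys) | e with any p xs
    ... | true  = refl
    ... | false = refl

    any-cong : {p q : A → Bool} (xs : List A) → (∀ x → p x ≡ q x) → any p xs ≡ any q xs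
    any-cong []       e = refl
    any-cong (x ∷ xs) e = cong₂ _∨_ (e x) (any-cong xs e)

    -- Tilings, faults and weights see a tile list only through such counts, so they are blind to regrouping.
    record SameCounts (s t : List A) : Set where
      constructor sameCounts
      field count-≡ : ∀ p → count p s ≡ count p t

    open SameCounts public

    sameCounts-refl : ∀ {s} → SameCounts s s
    sameCounts-refl = sameCounts (λ p → refl)

    sameCounts-++ : ∀ {s s′ t t′} → SameCounts s s′ → SameCounts t t′ → SameCounts (s ++ t) (s′ ++ t′)
    sameCounts-++ {s} {s′} {t} {t′} s∼s′ t∼t′ = sameCounts (λ p →
      trans (count-++ p s t) (trans (cong₂ _+_ (count-≡ s∼s′ p) (count-≡ t∼t′ p)) (sym (count-++ p s′ t′))))

    sameCounts-partition : ∀ q s → SameCounts s (filterᵇ q s ++ filterᵇ (not ∘ q) s)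
    sameCounts-partition q s = sameCounts (λ p →
      trans (count-partition p q s) (sym (count-++ p (filterᵇ q s) (filterᵇ (not ∘ q) s))))

    sameCounts-++ˡ : ∀ s {t t′} → SameCounts t t′ → SameCounts (s ++ t) (s ++ t′)
    sameCounts-++ˡ s = sameCounts-++ (sameCounts-refl {s})

    any-sameCounts : ∀ p {s t} → SameCounts s t → any p s ≡ any p t
    any-sameCounts p {s} {t} s∼t =
      trans (any≡count≢0 p s) (trans (cong (λ n → not (n ≡ᵇ 0)) (count-≡ s∼t p)) (sym (any≡count≢0 p t)))

    all-++ : (p : A → Bool) (xs ys : List A) → all p (xs ++ ys) ≡ all p xs ∧ all p ys
    all-++ p []       ys = refl
    all-++ p (x ∷ xs) ys rewrite all-++ p xs ys with p x
    ... | true  = refl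
    ... | false = refl

    all-cong : {p q : A → Bool} (xs : List A) → (∀ x → p x ≡ q x) → all p xs ≡ all q xs
    all-cong []       e = refl
    all-cong (x ∷ xs) e = cong₂ _∧_ (e x) (all-cong xs e)

  module _ {A B : Set} where

    filterᵇ-map : (p : B → Bool) (f : A → B) (xs : List A) → filterᵇ p (map f xs) ≡ map f (filterᵇ (p ∘ f) xs)
    filterᵇ-map p f []       = refl
    filterᵇ-map p f (x ∷ xs) with p (f x)
    ... | true  = cong (f x ∷_) (filterᵇ-map p f xs)
    ... | false = filterᵇ-map p f xs

    filterᵇ-concatMap : (p : B → Bool) (f : A → List B) (xs : List A) →
                        filterᵇ p (concatMap f xs) ≡ concatMap (filterᵇ p ∘ f) xs
    filterᵇ-concatMap p f []       = refl
    filterᵇ-concatMap p f (x ∷ xs) =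
      trans (filterᵇ-++ p (f x) (concatMap f xs)) (cong (filterᵇ p (f x) ++_) (filterᵇ-concatMap p f xs))

    count-map : (p : B → Bool) (f : A → B) (xs : List A) → count p (map f xs) ≡ count (p ∘ f) xs
    count-map p f []       = refl
    count-map p f (x ∷ xs) with p (f x)
    ... | true  = cong suc (count-map p f xs)
    ... | false = count-map p f xs

    any-map : (p : B → Bool) (f : A → B) (xs : List A) → any p (map f xs) ≡ any (p ∘ f) xs
    any-map p f []       = refl
    any-map p f (x ∷ xs) = cong (p (f x) ∨_) (any-map p f xs)

    All-concatMap : {P : A → Set} {Q : B → Set} (f : A → List B) {xs : List A} →
                    All P xs → (∀ x → P x → All Q (f x)) → All Q (concatMap f xs)
    All-concatMap f pxs g = concat⁺ (gmap⁺ (g _) pxs)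

    concatMap-cong-All : {P : A → Set} {f g : A → List B} {xs : List A} →
                         All P xs → (∀ x → P x → f x ≡ g x) → concatMap f xs ≡ concatMap g xs
    concatMap-cong-All []         e = refl
    concatMap-cong-All (px ∷ pxs) e = cong₂ _++_ (e _ px) (concatMap-cong-All pxs e)

    concatMap-nil : {P : A → Set} {f : A → List B} {xs : List A} →
                    All P xs → (∀ x → P x → f x ≡ []) → concatMap f xs ≡ []
    concatMap-nil []         e = refl
    concatMap-nil (px ∷ pxs) e rewrite e _ px = concatMap-nil pxs e

  upTo-+ : ∀ m n → upTo (m + n) ≡ upTo m ++ map (m +_) (upTo n)
  upTo-+ m zero rewrite +-identityʳ m = sym (++-identityʳ (upTo m))
  upTo-+ m (suc n) = begin
    upTo (m + suc n)                                   ≡⟨ cong upTo (+-suc m n) ⟩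
    upTo (suc (m + n))                                 ≡⟨ upTo-∷ʳ (m + n) ⟨
    upTo (m + n) ++ (m + n ∷ [])                       ≡⟨ cong (_++ (m + n ∷ [])) (upTo-+ m n) ⟩
    (upTo m ++ map (m +_) (upTo n)) ++ (m + n ∷ [])    ≡⟨ ++-assoc (upTo m) _ _ ⟩
    upTo m ++ (map (m +_) (upTo n) ++ (m + n ∷ []))    ≡⟨ cong (upTo m ++_) (map-++ (m +_) (upTo n) (n ∷ [])) ⟨
    upTo m ++ map (m +_) (upTo n ++ (n ∷ []))          ≡⟨ cong (λ z → upTo m ++ map (m +_) z) (upTo-∷ʳ n) ⟩
    upTo m ++ map (m +_) (upTo (suc n))                ∎
    where open ≡-Reasoning

  module _ {B : Set} where

    concatMap-upTo-suc : (f : ℕ → List B) (n : ℕ) → concatMap f (upTo (suc n)) ≡ concatMap f (upTo n) ++ f n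
    concatMap-upTo-suc f n =
      trans (cong (concatMap f) (sym (upTo-∷ʳ n)))
            (trans (concatMap-++ f (upTo n) (n ∷ [])) (cong (concatMap f (upTo n) ++_) (++-identityʳ (f n))))

    concatMap-upTo-single : (f : ℕ → List B) (n r : ℕ) → r < n → (∀ y → y < n → y ≢ r → f y ≡ []) →
                            concatMap f (upTo n) ≡ f r
    concatMap-upTo-single f (suc n) r r<1+n others with m<1+n⇒m<n∨m≡n r<1+n
    ... | inj₁ r<n = trans (concatMap-upTo-suc f n)
        (trans (cong₂ _++_ (concatMap-upTo-single f n r r<n (λ y y<n → others y (m<n⇒m<1+n y<n)))
                           (others n ≤-refl (λ n≡r → <⇒≢ r<n (sym n≡r))))
               (++-identityʳ (f r)))
    ... | inj₂ refl = trans (concatMap-upTo-suc f n)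
        (cong (_++ f n) (concatMap-nil (all-upTo n) (λ y y<n → others y (m<n⇒m<1+n y<n) (<⇒≢ y<n))))

  allBelow : ℕ → (ℕ → Bool) → Bool
  allBelow zero    f = true
  allBelow (suc n) f = allBelow n f ∧ f n

  all-upTo≡allBelow : ∀ (f : ℕ → Bool) n → all f (upTo n) ≡ allBelow n f
  all-upTo≡allBelow f zero    = refl
  all-upTo≡allBelow f (suc n) =
    trans (cong (all f) (sym (upTo-∷ʳ n)))
          (trans (all-++ f (upTo n) (n ∷ [])) (cong₂ _∧_ (all-upTo≡allBelow f n) (∧-identityʳ (f n))))

  allBelow-cong : ∀ n {f g : ℕ → Bool} → (∀ i → i < n → f i ≡ g i) → allBelow n f ≡ allBelow n g
  allBelow-cong zero    e = refl
  allBelow-cong (suc n) e = cong₂ _∧_ (allBelow-cong n (λ i i<n → e i (m<n⇒m<1+n i<n))) (e n ≤-refl)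

  allBelow-∧ : ∀ n (f g : ℕ → Bool) → allBelow n (λ i → f i ∧ g i) ≡ allBelow n f ∧ allBelow n g
  allBelow-∧ zero    f g = refl
  allBelow-∧ (suc n) f g rewrite allBelow-∧ n f g = interchange (allBelow n f) (allBelow n g) (f n) (g n)
    where
    interchange : ∀ w x y z → (w ∧ x) ∧ (y ∧ z) ≡ (w ∧ y) ∧ (x ∧ z)
    interchange true  true  y z = refl
    interchange true  false y z = sym (∧-zeroʳ y)
    interchange false x     y z = refl

  allBelow-+ : ∀ m n (f : ℕ → Bool) → allBelow (m + n) f ≡ allBelow m f ∧ allBelow n (λ i → f (m + i))
  allBelow-+ m zero f rewrite +-identityʳ m = sym (∧-identityʳ (allBelow m f))
  allBelow-+ m (suc n) f rewrite +-suc m n | allBelow-+ m n f with allBelow m f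
  ... | true  = refl
  ... | false = refl

  allBelow-false : ∀ n (f : ℕ → Bool) i → i < n → f i ≡ false → allBelow n f ≡ false
  allBelow-false (suc n) f i i<1+n e with m<1+n⇒m<n∨m≡n i<1+n
  ... | inj₁ i<n  rewrite allBelow-false n f i i<n e = refl
  ... | inj₂ refl rewrite e = ∧-zeroʳ (allBelow n f)

  allBelow-true : ∀ n (f : ℕ → Bool) → (∀ i → i < n → f i ≡ true) → allBelow n f ≡ true
  allBelow-true zero    f e = refl
  allBelow-true (suc n) f e rewrite allBelow-true n f (λ i i<n → e i (m<n⇒m<1+n i<n)) = e n ≤-refl

  noneBelow : (ℕ → Bool) → ℕ → Bool
  noneBelow φ c = allBelow c (λ d → not (0 <ᵇ d) ∨ not (φ d))

open BoolListLemmas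

module SublistSums {c ℓ} (S : Semiring c ℓ) where
  open Semiring S renaming (_+_ to _+ᴿ_; _*_ to _*ᴿ_)
  open import Relation.Binary.Reasoning.Setoid setoid
  open CommSemigroupProperties +-commutativeSemigroup using (interchange)

  listSum : List Carrier → Carrier
  listSum = foldr _+ᴿ_ 0#

  module _ {A : Set} where

    listSum-map-++ : (f : A → Carrier) (xs ys : List A) →
                     listSum (map f (xs ++ ys)) ≈ listSum (map f xs) +ᴿ listSum (map f ys)
    listSum-map-++ f []       ys = sym (+-identityˡ _)
    listSum-map-++ f (x ∷ xs) ys = trans (+-congˡ (listSum-map-++ f xs ys)) (sym (+-assoc _ _ _))

    listSum-map-cong : {f g : A → Carrier} (xs : List A) → (∀ x → f x ≈ g x) →
                       listSum (map f xs) ≈ listSum (map g xs)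
    listSum-map-cong []       f≈g = refl
    listSum-map-cong (x ∷ xs) f≈g = +-cong (f≈g x) (listSum-map-cong xs f≈g)

    listSum-map-+ : (f g : A → Carrier) (xs : List A) →
                    listSum (map (λ x → f x +ᴿ g x) xs) ≈ listSum (map f xs) +ᴿ listSum (map g xs)
    listSum-map-+ f g []       = sym (+-identityˡ 0#)
    listSum-map-+ f g (x ∷ xs) = trans (+-congˡ (listSum-map-+ f g xs)) (interchange _ _ _ _)

    listSum-map-0 : (xs : List A) → listSum (map (λ _ → 0#) xs) ≈ 0#
    listSum-map-0 []       = refl
    listSum-map-0 (x ∷ xs) = trans (+-identityˡ _) (listSum-map-0 xs)

    listSum-map-*ˡ : (a : Carrier) (f : A → Carrier) (xs : List A) →
                     listSum (map (λ x → a *ᴿ f x) xs) ≈ a *ᴿ listSum (map f xs)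
    listSum-map-*ˡ a f []       = sym (zeroʳ a)
    listSum-map-*ˡ a f (x ∷ xs) = trans (+-congˡ (listSum-map-*ˡ a f xs)) (sym (distribˡ a _ _))

    listSum-map-*ʳ : (a : Carrier) (f : A → Carrier) (xs : List A) →
                     listSum (map (λ x → f x *ᴿ a) xs) ≈ listSum (map f xs) *ᴿ a
    listSum-map-*ʳ a f []       = sym (zeroˡ a)
    listSum-map-*ʳ a f (x ∷ xs) = trans (+-congˡ (listSum-map-*ʳ a f xs)) (sym (distribʳ a _ _))

  module _ {A : Set} where

    sublistSum : List A → (List A → Carrier) → Carrier
    sublistSum L f = listSum (map f (sublists L))

    sublistSum-[] : (f : List A → Carrier) → sublistSum [] f ≈ f []
    sublistSum-[] f = +-identityʳ _

    sublistSum-∷ : (x : A) (L : List A) (f : List A → Carrier) →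
                   sublistSum (x ∷ L) f ≈ sublistSum L (λ s → f (x ∷ s)) +ᴿ sublistSum L f
    sublistSum-∷ x L f = begin
      listSum (map f (map (x ∷_) (sublists L) ++ sublists L))
        ≈⟨ listSum-map-++ f (map (x ∷_) (sublists L)) (sublists L) ⟩
      listSum (map f (map (x ∷_) (sublists L))) +ᴿ sublistSum L f
        ≡⟨ ≡.cong (λ l → listSum l +ᴿ sublistSum L f) (map-∘ (sublists L)) ⟨
      sublistSum L (λ s → f (x ∷ s)) +ᴿ sublistSum L f ∎

    sublistSum-cong : (L : List A) {f g : List A → Carrier} → (∀ s → f s ≈ g s) → sublistSum L f ≈ sublistSum L g
    sublistSum-cong L = listSum-map-cong (sublists L)

    sublistSum-cong-All : {P : A → Set} {L : List A} → All P L → {f g : List A → Carrier} →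
                          (∀ s → All P s → f s ≈ g s) → sublistSum L f ≈ sublistSum L g
    sublistSum-cong-All {L = []} [] {f} {g} f≈g = trans (sublistSum-[] f) (trans (f≈g [] []) (sym (sublistSum-[] g)))
    sublistSum-cong-All {L = x ∷ L} (px ∷ pxs) {f} {g} f≈g = begin
      sublistSum (x ∷ L) f
        ≈⟨ sublistSum-∷ x L f ⟩
      sublistSum L (λ s → f (x ∷ s)) +ᴿ sublistSum L f
        ≈⟨ +-cong (sublistSum-cong-All pxs (λ s ps → f≈g (x ∷ s) (px ∷ ps))) (sublistSum-cong-All pxs f≈g) ⟩
      sublistSum L (λ s → g (x ∷ s)) +ᴿ sublistSum L g
        ≈⟨ sublistSum-∷ x L g ⟨
      sublistSum (x ∷ L) g ∎

    sublistSum-+ : (L : List A) (f g : List A → Carrier) →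
                   sublistSum L (λ s → f s +ᴿ g s) ≈ sublistSum L f +ᴿ sublistSum L g
    sublistSum-+ L f g = listSum-map-+ f g (sublists L)

    sublistSum-*ˡ : (L : List A) (a : Carrier) (f : List A → Carrier) → sublistSum L (λ s → a *ᴿ f s) ≈ a *ᴿ sublistSum L f
    sublistSum-*ˡ L a f = listSum-map-*ˡ a f (sublists L)

    sublistSum-*ʳ : (L : List A) (a : Carrier) (f : List A → Carrier) → sublistSum L (λ s → f s *ᴿ a) ≈ sublistSum L f *ᴿ a
    sublistSum-*ʳ L a f = listSum-map-*ʳ a f (sublists L)

    sublistSum-product : (L M : List A) (f g : List A → Carrier) →
                         sublistSum L (λ s → sublistSum M (λ t → f s *ᴿ g t)) ≈ sublistSum L f *ᴿ sublistSum M g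
    sublistSum-product L M f g =
      trans (sublistSum-cong L (λ s → sublistSum-*ˡ M (f s) g)) (sublistSum-*ʳ L (sublistSum M g) f)

    sublistSum-zero : (L : List A) {f : List A → Carrier} → (∀ s → f s ≈ 0#) → sublistSum L f ≈ 0#
    sublistSum-zero L f≈0 = trans (sublistSum-cong L f≈0) (listSum-map-0 (sublists L))

    sublistSum-zero-All : {P : A → Set} {L : List A} → All P L → {f : List A → Carrier} →
                          (∀ s → All P s → f s ≈ 0#) → sublistSum L f ≈ 0#
    sublistSum-zero-All {L = L} pL f≈0 = trans (sublistSum-cong-All pL f≈0) (listSum-map-0 (sublists L))

    sublistSum-++ : (L M : List A) (f : List A → Carrier) →
                    sublistSum (L ++ M) f ≈ sublistSum L (λ s → sublistSum M (λ t → f (s ++ t)))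
    sublistSum-++ []      M f = sym (sublistSum-[] (λ s → sublistSum M (λ t → f (s ++ t))))
    sublistSum-++ (x ∷ L) M f = begin
      sublistSum (x ∷ L ++ M) f
        ≈⟨ sublistSum-∷ x (L ++ M) f ⟩
      sublistSum (L ++ M) (λ s → f (x ∷ s)) +ᴿ sublistSum (L ++ M) f
        ≈⟨ +-cong (sublistSum-++ L M (λ s → f (x ∷ s))) (sublistSum-++ L M f) ⟩
      sublistSum L (λ s → sublistSum M (λ t → f (x ∷ s ++ t))) +ᴿ sublistSum L (λ s → sublistSum M (λ t → f (s ++ t)))
        ≈⟨ sublistSum-∷ x L _ ⟨
      sublistSum (x ∷ L) (λ s → sublistSum M (λ t → f (s ++ t))) ∎

    sublistSum-only-[] : {L : List A} {f : List A → Carrier} → All (λ x → ∀ t → f (x ∷ t) ≈ 0#) L →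
                         sublistSum L f ≈ f []
    sublistSum-only-[] {[]}    {f} []            = sublistSum-[] f
    sublistSum-only-[] {x ∷ L} {f} (fx≈0 ∷ rest) = begin
      sublistSum (x ∷ L) f                              ≈⟨ sublistSum-∷ x L f ⟩
      sublistSum L (λ s → f (x ∷ s)) +ᴿ sublistSum L f  ≈⟨ +-cong (sublistSum-zero L fx≈0) (sublistSum-only-[] rest) ⟩
      0# +ᴿ f []                                        ≈⟨ +-identityˡ _ ⟩
      f []                                              ∎

    sublistSum-partition : (q : A → Bool) (L : List A) (F : List A → List A → Carrier) →
      sublistSum L (λ s → F (filterᵇ q s) (filterᵇ (not ∘ q) s)) ≈
      sublistSum (filterᵇ q L) (λ s → sublistSum (filterᵇ (not ∘ q) L) (F s))
    sublistSum-partition q [] F =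
      trans (sublistSum-[] (λ s → F (filterᵇ q s) (filterᵇ (not ∘ q) s)))
            (sym (trans (sublistSum-[] (λ s → sublistSum [] (F s))) (sublistSum-[] (F []))))
    sublistSum-partition q (x ∷ L) F with q x in qx
    ... | true = begin
      sublistSum (x ∷ L) G
        ≈⟨ sublistSum-∷ x L G ⟩
      sublistSum L (λ s → G (x ∷ s)) +ᴿ sublistSum L G
        ≈⟨ +-congʳ (sublistSum-cong L (λ s → reflexive
             (≡.cong₂ F (filterᵇ-accept q s qx) (filterᵇ-reject (not ∘ q) s (≡.cong not qx))))) ⟩
      sublistSum L (λ s → F (x ∷ filterᵇ q s) (filterᵇ (not ∘ q) s)) +ᴿ sublistSum L G
        ≈⟨ +-cong (sublistSum-partition q L (λ s → F (x ∷ s))) (sublistSum-partition q L F) ⟩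
      sublistSum (filterᵇ q L) (λ s → sublistSum R (F (x ∷ s))) +ᴿ sublistSum (filterᵇ q L) (λ s → sublistSum R (F s))
        ≈⟨ sublistSum-∷ x (filterᵇ q L) _ ⟨
      sublistSum (x ∷ filterᵇ q L) (λ s → sublistSum R (F s)) ∎
      where
      G : List A → Carrier
      G s = F (filterᵇ q s) (filterᵇ (not ∘ q) s)
      R : List A
      R = filterᵇ (not ∘ q) L
    ... | false = begin
      sublistSum (x ∷ L) G
        ≈⟨ sublistSum-∷ x L G ⟩
      sublistSum L (λ s → G (x ∷ s)) +ᴿ sublistSum L G
        ≈⟨ +-congʳ (sublistSum-cong L (λ s → reflexive
             (≡.cong₂ F (filterᵇ-reject q s qx) (filterᵇ-accept (not ∘ q) s (≡.cong not qx))))) ⟩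
      sublistSum L (λ s → F (filterᵇ q s) (x ∷ filterᵇ (not ∘ q) s)) +ᴿ sublistSum L G
        ≈⟨ +-cong (sublistSum-partition q L (λ s t → F s (x ∷ t))) (sublistSum-partition q L F) ⟩
      sublistSum (filterᵇ q L) (λ s → sublistSum R (λ t → F s (x ∷ t))) +ᴿ sublistSum (filterᵇ q L) (λ s → sublistSum R (F s))
        ≈⟨ sublistSum-+ (filterᵇ q L) _ _ ⟨
      sublistSum (filterᵇ q L) (λ s → sublistSum R (λ t → F s (x ∷ t)) +ᴿ sublistSum R (F s))
        ≈⟨ sublistSum-cong (filterᵇ q L) (λ s → sublistSum-∷ x R (F s)) ⟨
      sublistSum (filterᵇ q L) (λ s → sublistSum (x ∷ R) (F s)) ∎
      where
      G : List A → Carrier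
      G s = F (filterᵇ q s) (filterᵇ (not ∘ q) s)
      R : List A
      R = filterᵇ (not ∘ q) L

    sublistSum-split : (q : A → Bool) (L : List A) (f : List A → Carrier) → (∀ {s t} → SameCounts s t → f s ≈ f t) →
                       sublistSum L f ≈ sublistSum (filterᵇ q L) (λ s → sublistSum (filterᵇ (not ∘ q) L) (λ t → f (s ++ t)))
    sublistSum-split q L f f-resp = trans (sublistSum-cong L (λ s → f-resp (sameCounts-partition q s)))
                                          (sublistSum-partition q L (λ s t → f (s ++ t)))

    sublistSum-restrict : (q : A → Bool) (L : List A) (f : List A → Carrier) → (∀ {s t} → SameCounts s t → f s ≈ f t) →
                          All (λ x → ∀ s t → f (s ++ x ∷ t) ≈ 0#) (filterᵇ (not ∘ q) L) →
                          sublistSum L f ≈ sublistSum (filterᵇ q L) f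
    sublistSum-restrict q L f f-resp kills = trans (sublistSum-split q L f f-resp) (sublistSum-cong (filterᵇ q L) (λ s →
      trans (sublistSum-only-[] (All.map (λ kill → kill s) kills)) (reflexive (≡.cong f (++-identityʳ s)))))

  sublistSum-map : {A B : Set} (σ : A → B) (L : List A) (f : List B → Carrier) →
                   sublistSum (map σ L) f ≈ sublistSum L (λ s → f (map σ s))
  sublistSum-map σ []      f = trans (sublistSum-[] f) (sym (sublistSum-[] (λ s → f (map σ s))))
  sublistSum-map σ (x ∷ L) f = begin
    sublistSum (σ x ∷ map σ L) f
      ≈⟨ sublistSum-∷ (σ x) (map σ L) f ⟩
    sublistSum (map σ L) (λ s → f (σ x ∷ s)) +ᴿ sublistSum (map σ L) f
      ≈⟨ +-cong (sublistSum-map σ L (λ s → f (σ x ∷ s))) (sublistSum-map σ L f) ⟩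
    sublistSum L (λ s → f (σ x ∷ map σ s)) +ᴿ sublistSum L (λ s → f (map σ s))
      ≈⟨ sublistSum-∷ x L (λ s → f (map σ s)) ⟨
    sublistSum (x ∷ L) (λ s → f (map σ s)) ∎

module TileGeometry (k : ℕ) (1≤k : 1 ≤ k) where
  open ≡
  open ℕₚ

  x₀ x₁ y₀ y₁ : Tile → ℕ
  x₀ (vert x y)  = x
  x₀ (horiz x y) = x
  x₁ (vert x y)  = suc x
  x₁ (horiz x y) = x + k
  y₀ (vert x y)  = y
  y₀ (horiz x y) = y
  y₁ (vert x y)  = y + k
  y₁ (horiz x y) = suc y

  x₀<x₁ : ∀ t → x₀ t < x₁ t
  x₀<x₁ (vert x y)  = ≤-refl
  x₀<x₁ (horiz x y) = subst (_≤ x + k) (+-comm x 1) (+-monoʳ-≤ x 1≤k)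

  y₀<y₁ : ∀ t → y₀ t < y₁ t
  y₀<y₁ (vert x y)  = subst (_≤ y + k) (+-comm y 1) (+-monoʳ-≤ y 1≤k)
  y₀<y₁ (horiz x y) = ≤-refl

  covers≡ : ∀ i j t → covers k i j t ≡ (x₀ t ≤ᵇ i) ∧ (i <ᵇ x₁ t) ∧ (y₀ t ≤ᵇ j) ∧ (j <ᵇ y₁ t)
  covers≡ i j (vert x y)  = refl
  covers≡ i j (horiz x y) = refl

  inside≡ : ∀ n t → inside k n t ≡ (x₁ t ≤ᵇ n) ∧ (y₁ t ≤ᵇ k + k)
  inside≡ n (vert x y)  = refl
  inside≡ n (horiz x y) = refl

  meetsVLine≡ : ∀ c t → meetsVLine k c t ≡ (x₀ t <ᵇ c) ∧ (c <ᵇ x₁ t)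
  meetsVLine≡ c (vert x y)  = refl
  meetsVLine≡ c (horiz x y) = refl

  meetsHLine≡ : ∀ c t → meetsHLine k c t ≡ (y₀ t <ᵇ c) ∧ (c <ᵇ y₁ t)
  meetsHLine≡ c (vert x y)  = refl
  meetsHLine≡ c (horiz x y) = refl

  covers-true : ∀ {i j} t → x₀ t ≤ i → i < x₁ t → y₀ t ≤ j → j < y₁ t → covers k i j t ≡ true
  covers-true {i} {j} t a b c d rewrite covers≡ i j t | ≤ᵇ-true a | <ᵇ-true b | ≤ᵇ-true c | <ᵇ-true d = refl

  covers-false-left : ∀ {i j} t → i < x₀ t → covers k i j t ≡ false
  covers-false-left {i} {j} t i<x₀ rewrite covers≡ i j t | ≤ᵇ-false i<x₀ = refl

  covers-false-right : ∀ {i j} t → x₁ t ≤ i → covers k i j t ≡ false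
  covers-false-right {i} {j} t x₁≤i rewrite covers≡ i j t | <ᵇ-false x₁≤i = ∧-zeroʳ (x₀ t ≤ᵇ i)

  covers-false-below : ∀ {i j} t → j < y₀ t → covers k i j t ≡ false
  covers-false-below {i} {j} t j<y₀ rewrite covers≡ i j t | ≤ᵇ-false j<y₀ =
    trans (cong ((x₀ t ≤ᵇ i) ∧_) (∧-zeroʳ (i <ᵇ x₁ t))) (∧-zeroʳ (x₀ t ≤ᵇ i))

  covers-false-above : ∀ {i j} t → y₁ t ≤ j → covers k i j t ≡ false
  covers-false-above {i} {j} t y₁≤j rewrite covers≡ i j t | <ᵇ-false y₁≤j
    with x₀ t ≤ᵇ i | i <ᵇ x₁ t | y₀ t ≤ᵇ j
  ... | true  | true  | true  = refl
  ... | true  | true  | false = refl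
  ... | true  | false | _     = refl
  ... | false | _     | _     = refl

  meetsVLine-false-left : ∀ {c} t → c ≤ x₀ t → meetsVLine k c t ≡ false
  meetsVLine-false-left {c} t c≤x₀ rewrite meetsVLine≡ c t | <ᵇ-false c≤x₀ = refl

  meetsVLine-false-right : ∀ {c} t → x₁ t ≤ c → meetsVLine k c t ≡ false
  meetsVLine-false-right {c} t x₁≤c rewrite meetsVLine≡ c t | <ᵇ-false x₁≤c = ∧-zeroʳ _

  meetsVLine-true : ∀ {c} t → x₀ t < c → c < x₁ t → meetsVLine k c t ≡ true
  meetsVLine-true {c} t a b rewrite meetsVLine≡ c t | <ᵇ-true a | <ᵇ-true b = refl

  meetsHLine-false-below : ∀ {c} t → c ≤ y₀ t → meetsHLine k c t ≡ false
  meetsHLine-false-below {c} t c≤y₀ rewrite meetsHLine≡ c t | <ᵇ-false c≤y₀ = refl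

  meetsHLine-false-above : ∀ {c} t → y₁ t ≤ c → meetsHLine k c t ≡ false
  meetsHLine-false-above {c} t y₁≤c rewrite meetsHLine≡ c t | <ᵇ-false y₁≤c = ∧-zeroʳ _

  meetsHLine-true : ∀ {c} t → y₀ t < c → c < y₁ t → meetsHLine k c t ≡ true
  meetsHLine-true {c} t a b rewrite meetsHLine≡ c t | <ᵇ-true a | <ᵇ-true b = refl

  shift : ℕ → Tile → Tile
  shift c (vert x y)  = vert (c + x) y
  shift c (horiz x y) = horiz (c + x) y

  isVert-shift : ∀ c t → isVert (shift c t) ≡ isVert t
  isVert-shift c (vert x y)  = refl
  isVert-shift c (horiz x y) = refl

  x₀-shift : ∀ c t → x₀ (shift c t) ≡ c + x₀ t
  x₀-shift c (vert x y)  = refl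
  x₀-shift c (horiz x y) = refl

  x₁-shift : ∀ c t → x₁ (shift c t) ≡ c + x₁ t
  x₁-shift c (vert x y)  = sym (+-suc c x)
  x₁-shift c (horiz x y) = +-assoc c x k

  covers-shift : ∀ c i j t → covers k (c + i) j (shift c t) ≡ covers k i j t
  covers-shift c i j (vert x y)  rewrite ≤ᵇ-+ˡ c x i | sym (+-suc c x) | <ᵇ-+ˡ c i (suc x) = refl
  covers-shift c i j (horiz x y) rewrite ≤ᵇ-+ˡ c x i | +-assoc c x k | <ᵇ-+ˡ c i (x + k) = refl

  meetsHLine-shift : ∀ c d t → meetsHLine k d (shift c t) ≡ meetsHLine k d t
  meetsHLine-shift c d (vert x y)  = refl
  meetsHLine-shift c d (horiz x y) = refl

  inside-shift : ∀ c m t → inside k (c + m) (shift c t) ≡ inside k m t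
  inside-shift c m (vert x y)  = cong (_∧ (y + k ≤ᵇ k + k)) (<ᵇ-+ˡ c x m)
  inside-shift c m (horiz x y) rewrite +-assoc c x k = cong (_∧ (suc y ≤ᵇ k + k)) (≤ᵇ-+ˡ c (x + k) m)

  leftOf rightOf : ℕ → Tile → Bool
  leftOf  c t = x₁ t ≤ᵇ c
  rightOf c t = c ≤ᵇ x₀ t

  column : ℕ → List Tile
  column x = concatMap (λ y → vert x y ∷ horiz x y ∷ []) (upTo (k + k))

  column-shift : ∀ c x → column (c + x) ≡ map (shift c) (column x)
  column-shift c x = sym (map-concatMap (shift c) (λ y → vert x y ∷ horiz x y ∷ []) (upTo (k + k)))

  columns-shift : ∀ c xs → concatMap column (map (c +_) xs) ≡ map (shift c) (concatMap column xs)
  columns-shift c xs = trans (concatMap-map column (c +_) xs)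
    (trans (concatMap-cong (column-shift c) xs) (sym (map-concatMap (shift c) column xs)))

  placements-+ : ∀ c m → placements k (c + m) ≡
                 filterᵇ (inside k (c + m)) (concatMap column (upTo c)) ++ map (shift c) (placements k m)
  placements-+ c m = begin
    filterᵇ P (concatMap column (upTo (c + m)))
      ≡⟨ cong (λ xs → filterᵇ P (concatMap column xs)) (upTo-+ c m) ⟩
    filterᵇ P (concatMap column (upTo c ++ map (c +_) (upTo m)))
      ≡⟨ cong (filterᵇ P) (concatMap-++ column (upTo c) _) ⟩
    filterᵇ P (concatMap column (upTo c) ++ concatMap column (map (c +_) (upTo m)))
      ≡⟨ filterᵇ-++ P (concatMap column (upTo c)) _ ⟩
    Left ++ filterᵇ P (concatMap column (map (c +_) (upTo m)))
      ≡⟨ cong (λ ts → Left ++ filterᵇ P ts) (columns-shift c (upTo m)) ⟩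
    Left ++ filterᵇ P (map (shift c) (concatMap column (upTo m)))
      ≡⟨ cong (Left ++_) (filterᵇ-map P (shift c) (concatMap column (upTo m))) ⟩
    Left ++ map (shift c) (filterᵇ (P ∘ shift c) (concatMap column (upTo m)))
      ≡⟨ cong (λ ts → Left ++ map (shift c) ts) (filterᵇ-cong (concatMap column (upTo m)) (inside-shift c m)) ⟩
    Left ++ map (shift c) (placements k m) ∎
    where
    open ≡-Reasoning
    P : Tile → Bool
    P = inside k (c + m)
    Left : List Tile
    Left = filterᵇ P (concatMap column (upTo c))

  All-x₀<-columns : ∀ c → All (λ t → x₀ t < c) (concatMap column (upTo c))
  All-x₀<-columns c = All-concatMap column (all-upTo c) (λ x x<c →
    All-concatMap (λ y → vert x y ∷ horiz x y ∷ []) (all-upTo (k + k)) (λ _ _ → x<c ∷ x<c ∷ []))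

  All-≤x₀-shift : ∀ c ts → All (λ t → c ≤ x₀ t) (map (shift c) ts)
  All-≤x₀-shift c ts = map⁺ (universal (λ t → subst (c ≤_) (sym (x₀-shift c t)) (m≤m+n c (x₀ t))) ts)

  All-<x₁-shift : ∀ c ts → All (λ t → c < x₁ t) (map (shift c) ts)
  All-<x₁-shift c ts = map⁺ (universal (λ t →
    subst (c <_) (sym (x₁-shift c t)) (m<m+n c (≤-trans (s≤s z≤n) (x₀<x₁ t)))) ts)

  placements-leftOf : ∀ c m → filterᵇ (leftOf c) (placements k (c + m)) ≡ placements k c
  placements-leftOf c m = begin
    filterᵇ (leftOf c) (placements k (c + m))                  ≡⟨ cong (filterᵇ (leftOf c)) (placements-+ c m) ⟩
    filterᵇ (leftOf c) (Left ++ Right)                         ≡⟨ filterᵇ-++ (leftOf c) Left Right ⟩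
    filterᵇ (leftOf c) Left ++ filterᵇ (leftOf c) Right        ≡⟨ cong₂ _++_ left right ⟩
    placements k c ++ []                                       ≡⟨ ++-identityʳ _ ⟩
    placements k c                                             ∎
    where
    open ≡-Reasoning
    Left Right : List Tile
    Left  = filterᵇ (inside k (c + m)) (concatMap column (upTo c))
    Right = map (shift c) (placements k m)
    inside-leftOf : ∀ t → (inside k (c + m) t ∧ leftOf c t) ≡ inside k c t
    inside-leftOf t rewrite inside≡ (c + m) t | inside≡ c t with x₁ t ≤ᵇ c in e | x₁ t ≤ᵇ c + m in e′
    ... | false | _     = ∧-zeroʳ _
    ... | true  | true  = ∧-identityʳ _
    ... | true  | false = ⊥-elim (<⇒≱ (≤ᵇ-false⇒> e′) (≤-trans (≤ᵇ-true⇒≤ {x₁ t} e) (m≤m+n c m)))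
    left : filterᵇ (leftOf c) Left ≡ placements k c
    left = trans (filterᵇ-filterᵇ (leftOf c) (inside k (c + m)) (concatMap column (upTo c)))
                 (filterᵇ-cong (concatMap column (upTo c)) inside-leftOf)
    right : filterᵇ (leftOf c) Right ≡ []
    right = filterᵇ-none (All.map ≤ᵇ-false (All-<x₁-shift c (placements k m)))

  placements-rightOf : ∀ c m → filterᵇ (rightOf c) (placements k (c + m)) ≡ map (shift c) (placements k m)
  placements-rightOf c m = begin
    filterᵇ (rightOf c) (placements k (c + m))                 ≡⟨ cong (filterᵇ (rightOf c)) (placements-+ c m) ⟩
    filterᵇ (rightOf c) (Left ++ Right)                        ≡⟨ filterᵇ-++ (rightOf c) Left Right ⟩
    filterᵇ (rightOf c) Left ++ filterᵇ (rightOf c) Right      ≡⟨ cong₂ _++_ left right ⟩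
    Right                                                      ∎
    where
    open ≡-Reasoning
    Left Right : List Tile
    Left  = filterᵇ (inside k (c + m)) (concatMap column (upTo c))
    Right = map (shift c) (placements k m)
    left : filterᵇ (rightOf c) Left ≡ []
    left = filterᵇ-none (All-filterᵇ⁺ (inside k (c + m)) (All.map ≤ᵇ-false (All-x₀<-columns c)))
    right : filterᵇ (rightOf c) Right ≡ Right
    right = filterᵇ-all (All.map ≤ᵇ-true (All-≤x₀-shift c (placements k m)))

  filterᵇ-rightOf-notLeftOf : ∀ c (L : List Tile) →
                              filterᵇ (rightOf c) (filterᵇ (not ∘ leftOf c) L) ≡ filterᵇ (rightOf c) L
  filterᵇ-rightOf-notLeftOf c L = trans (filterᵇ-filterᵇ _ _ L) (filterᵇ-cong L rightOf⇒notLeftOf)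
    where
    rightOf⇒notLeftOf : ∀ t → (not (leftOf c t) ∧ rightOf c t) ≡ rightOf c t
    rightOf⇒notLeftOf t with rightOf c t in e
    ... | false = ∧-zeroʳ _
    ... | true rewrite ≤ᵇ-false {x₁ t} {c} (≤-<-trans (≤ᵇ-true⇒≤ {c} e) (x₀<x₁ t)) = refl

  inStrip : ℕ → Tile → Bool
  inStrip r t = (r ≤ᵇ y₀ t) ∧ (y₁ t ≤ᵇ r + k)

  stripPlacements : ℕ → ℕ → List Tile
  stripPlacements r n = filterᵇ (inStrip r) (placements k n)

  inStrip-shift : ∀ r c t → inStrip r (shift c t) ≡ inStrip r t
  inStrip-shift r c (vert x y)  = refl
  inStrip-shift r c (horiz x y) = refl

  stripPlacements-rightOf : ∀ r c m → filterᵇ (rightOf c) (stripPlacements r (c + m)) ≡ map (shift c) (stripPlacements r m)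
  stripPlacements-rightOf r c m = begin
    filterᵇ (rightOf c) (filterᵇ (inStrip r) (placements k (c + m)))
      ≡⟨ filterᵇ-comm (rightOf c) (inStrip r) (placements k (c + m)) ⟩
    filterᵇ (inStrip r) (filterᵇ (rightOf c) (placements k (c + m)))
      ≡⟨ cong (filterᵇ (inStrip r)) (placements-rightOf c m) ⟩
    filterᵇ (inStrip r) (map (shift c) (placements k m))
      ≡⟨ filterᵇ-map (inStrip r) (shift c) (placements k m) ⟩
    map (shift c) (filterᵇ (inStrip r ∘ shift c) (placements k m))
      ≡⟨ cong (map (shift c)) (filterᵇ-cong (placements k m) (inStrip-shift r c)) ⟩
    map (shift c) (stripPlacements r m) ∎
    where open ≡-Reasoning

  firstColumn : ℕ → ℕ → List Tile
  firstColumn r m = filterᵇ (not ∘ rightOf 1) (stripPlacements r (suc m))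

  firstColumn≡ : ∀ r m → firstColumn r m ≡ filterᵇ (λ t → inside k (suc m) t ∧ inStrip r t) (column 0)
  firstColumn≡ r m = begin
    filterᵇ (not ∘ rightOf 1) (filterᵇ (inStrip r) (placements k (1 + m)))
      ≡⟨ filterᵇ-comm (not ∘ rightOf 1) (inStrip r) (placements k (1 + m)) ⟩
    filterᵇ (inStrip r) (filterᵇ (not ∘ rightOf 1) (placements k (1 + m)))
      ≡⟨ cong (λ ts → filterᵇ (inStrip r) (filterᵇ (not ∘ rightOf 1) ts)) (placements-+ 1 m) ⟩
    filterᵇ (inStrip r) (filterᵇ (not ∘ rightOf 1) (Left ++ Right))
      ≡⟨ cong (filterᵇ (inStrip r)) (filterᵇ-++ (not ∘ rightOf 1) Left Right) ⟩
    filterᵇ (inStrip r) (filterᵇ (not ∘ rightOf 1) Left ++ filterᵇ (not ∘ rightOf 1) Right)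
      ≡⟨ cong (filterᵇ (inStrip r)) (cong₂ _++_ left right) ⟩
    filterᵇ (inStrip r) (Left ++ [])
      ≡⟨ cong (filterᵇ (inStrip r)) (++-identityʳ Left) ⟩
    filterᵇ (inStrip r) Left
      ≡⟨ cong (λ ts → filterᵇ (inStrip r) (filterᵇ (inside k (suc m)) ts)) (++-identityʳ (column 0)) ⟩
    filterᵇ (inStrip r) (filterᵇ (inside k (suc m)) (column 0))
      ≡⟨ filterᵇ-filterᵇ (inStrip r) (inside k (suc m)) (column 0) ⟩
    filterᵇ (λ t → inside k (suc m) t ∧ inStrip r t) (column 0) ∎
    where
    open ≡-Reasoning
    Left Right : List Tile
    Left  = filterᵇ (inside k (1 + m)) (concatMap column (upTo 1))
    Right = map (shift 1) (placements k m)
    left : filterᵇ (not ∘ rightOf 1) Left ≡ Left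
    left = filterᵇ-all (All-filterᵇ⁺ (inside k (1 + m)) (All.map (cong not ∘ ≤ᵇ-false) (All-x₀<-columns 1)))
    right : filterᵇ (not ∘ rightOf 1) Right ≡ []
    right = filterᵇ-none (All.map (cong not ∘ ≤ᵇ-true) (All-≤x₀-shift 1 (placements k m)))

  horizontalStack : ℕ → ℕ → List Tile
  horizontalStack r zero    = []
  horizontalStack r (suc j) = horizontalStack r j ++ horiz 0 (r + j) ∷ []

  firstColumn-vertical : ∀ r m → r ≤ k → filterᵇ isVert (firstColumn r m) ≡ vert 0 r ∷ []
  firstColumn-vertical r m r≤k = begin
    filterᵇ isVert (firstColumn r m)                        ≡⟨ cong (filterᵇ isVert) (firstColumn≡ r m) ⟩
    filterᵇ isVert (filterᵇ P (column 0))                   ≡⟨ filterᵇ-filterᵇ isVert P (column 0) ⟩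
    filterᵇ Pv (column 0)                                   ≡⟨ filterᵇ-concatMap Pv cell (upTo (k + k)) ⟩
    concatMap (filterᵇ Pv ∘ cell) (upTo (k + k))            ≡⟨ concatMap-upTo-single _ (k + k) r (≤-<-trans r≤k (m<m+n k 1≤k)) others ⟩
    filterᵇ Pv (cell r)                                     ≡⟨ filterᵇ-accept Pv {vert 0 r} (horiz 0 r ∷ []) accepted ⟩
    vert 0 r ∷ filterᵇ Pv (horiz 0 r ∷ [])                  ≡⟨ cong (vert 0 r ∷_) (filterᵇ-reject Pv {horiz 0 r} [] (∧-zeroʳ _)) ⟩
    vert 0 r ∷ []                                           ∎
    where
    open ≡-Reasoning
    P Pv : Tile → Bool
    P  t = inside k (suc m) t ∧ inStrip r t
    Pv t = P t ∧ isVert t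
    cell : ℕ → List Tile
    cell y = vert 0 y ∷ horiz 0 y ∷ []
    accepted : Pv (vert 0 r) ≡ true
    accepted rewrite ≤ᵇ-true (+-monoˡ-≤ k r≤k) | ≤ᵇ-true (≤-refl {r}) | ≤ᵇ-true (≤-refl {r + k}) = refl
    outside : ∀ y → y ≢ r → inStrip r (vert 0 y) ≡ false
    outside y y≢r with <-cmp y r
    ... | tri< y<r _ _ rewrite ≤ᵇ-false y<r = refl
    ... | tri≈ _ y≡r _ = ⊥-elim (y≢r y≡r)
    ... | tri> _ _ y>r rewrite ≤ᵇ-true (<⇒≤ y>r) = ≤ᵇ-false (+-monoˡ-< k y>r)
    others : ∀ y → y < k + k → y ≢ r → filterᵇ Pv (cell y) ≡ []
    others y _ y≢r = trans
      (filterᵇ-reject Pv {vert 0 y} (horiz 0 y ∷ [])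
        (trans (∧-identityʳ _) (trans (cong (inside k (suc m) (vert 0 y) ∧_) (outside y y≢r)) (∧-zeroʳ _))))
      (filterᵇ-reject Pv {horiz 0 y} [] (∧-zeroʳ _))

  stackRow : ℕ → ℕ → List Tile
  stackRow r y = if (r ≤ᵇ y) ∧ (suc y ≤ᵇ r + k) then horiz 0 y ∷ [] else []

  concatMap-stackRow : ∀ r n → r + k ≤ n → concatMap (stackRow r) (upTo n) ≡ horizontalStack r k
  concatMap-stackRow r n r+k≤n =
    trans (cong (λ z → concatMap (stackRow r) (upTo z)) (sym (m+[n∸m]≡n r+k≤n))) (beyond (n ∸ (r + k)))
    where
    open ≡-Reasoning
    below : concatMap (stackRow r) (upTo r) ≡ []
    below = concatMap-nil (all-upTo r) (λ y y<r → cong (λ b → if b ∧ (suc y ≤ᵇ r + k) then horiz 0 y ∷ [] else []) (≤ᵇ-false y<r))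
    within : ∀ j → j ≤ k → concatMap (stackRow r) (upTo (r + j)) ≡ horizontalStack r j
    within zero    _   = trans (cong (λ z → concatMap (stackRow r) (upTo z)) (+-identityʳ r)) below
    within (suc j) j<k = begin
      concatMap (stackRow r) (upTo (r + suc j))             ≡⟨ cong (λ z → concatMap (stackRow r) (upTo z)) (+-suc r j) ⟩
      concatMap (stackRow r) (upTo (suc (r + j)))           ≡⟨ concatMap-upTo-suc (stackRow r) (r + j) ⟩
      concatMap (stackRow r) (upTo (r + j)) ++ stackRow r (r + j) ≡⟨ cong₂ _++_ (within j (<⇒≤ j<k)) row ⟩
      horizontalStack r (suc j)                             ∎
      where
      row : stackRow r (r + j) ≡ horiz 0 (r + j) ∷ []
      row rewrite ≤ᵇ-true (m≤m+n r j) | ≤ᵇ-true (subst (_≤ r + k) (+-suc r j) (+-monoʳ-≤ r j<k)) = refl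
    beyond : ∀ d → concatMap (stackRow r) (upTo (r + k + d)) ≡ horizontalStack r k
    beyond zero    = trans (cong (λ z → concatMap (stackRow r) (upTo z)) (+-identityʳ (r + k))) (within k ≤-refl)
    beyond (suc d) = begin
      concatMap (stackRow r) (upTo (r + k + suc d))         ≡⟨ cong (λ z → concatMap (stackRow r) (upTo z)) (+-suc (r + k) d) ⟩
      concatMap (stackRow r) (upTo (suc (r + k + d)))       ≡⟨ concatMap-upTo-suc (stackRow r) (r + k + d) ⟩
      concatMap (stackRow r) (upTo (r + k + d)) ++ stackRow r (r + k + d) ≡⟨ cong₂ _++_ (beyond d) row ⟩
      horizontalStack r k ++ []                             ≡⟨ ++-identityʳ _ ⟩
      horizontalStack r k                                   ∎
      where
      row : stackRow r (r + k + d) ≡ []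
      row rewrite ≤ᵇ-false {suc (r + k + d)} {r + k} (s≤s (m≤m+n (r + k) d)) =
        cong (λ b → if b then horiz 0 (r + k + d) ∷ [] else []) (∧-zeroʳ _)

  firstColumn-horizontal : ∀ r m → r ≤ k →
    filterᵇ (not ∘ isVert) (firstColumn r m) ≡ (if k ≤ᵇ suc m then horizontalStack r k else [])
  firstColumn-horizontal r m r≤k = begin
    filterᵇ (not ∘ isVert) (firstColumn r m)                ≡⟨ cong (filterᵇ (not ∘ isVert)) (firstColumn≡ r m) ⟩
    filterᵇ (not ∘ isVert) (filterᵇ P (column 0))           ≡⟨ filterᵇ-filterᵇ (not ∘ isVert) P (column 0) ⟩
    filterᵇ Ph (column 0)                                   ≡⟨ filterᵇ-concatMap Ph cell (upTo (k + k)) ⟩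
    concatMap (filterᵇ Ph ∘ cell) (upTo (k + k))            ≡⟨ fits (k ≤ᵇ suc m) refl ⟩
    (if k ≤ᵇ suc m then horizontalStack r k else [])        ∎
    where
    open ≡-Reasoning
    P Ph : Tile → Bool
    P  t = inside k (suc m) t ∧ inStrip r t
    Ph t = P t ∧ not (isVert t)
    cell : ℕ → List Tile
    cell y = vert 0 y ∷ horiz 0 y ∷ []
    fits : ∀ b → (k ≤ᵇ suc m) ≡ b → concatMap (filterᵇ Ph ∘ cell) (upTo (k + k)) ≡ (if b then horizontalStack r k else [])
    fits false k>1+m = concatMap-nil (all-upTo (k + k)) none
      where
      none : ∀ y → y < k + k → filterᵇ Ph (cell y) ≡ []
      none y _ rewrite k>1+m = cong (λ b → if b then vert 0 y ∷ [] else []) (∧-zeroʳ _)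
    fits true  k≤1+m = trans (concatMap-cong-All (all-upTo (k + k)) row) (concatMap-stackRow r (k + k) (+-monoˡ-≤ k r≤k))
      where
      row : ∀ y → y < k + k → filterᵇ Ph (cell y) ≡ stackRow r y
      row y y<2k rewrite k≤1+m | ≤ᵇ-true y<2k | ∧-zeroʳ (inside k (suc m) (vert 0 y) ∧ inStrip r (vert 0 y))
        | ∧-identityʳ ((r ≤ᵇ y) ∧ (suc y ≤ᵇ r + k)) = refl

  coveredOnce : ℕ → ℕ → List Tile → Bool
  coveredOnce i j s = count (covers k i j) s ≡ᵇ 1

  tilesRectangle : ℕ → List Tile → Bool
  tilesRectangle n s = allBelow n (λ i → allBelow (k + k) (λ j → coveredOnce i j s))

  isTiling≡ : ∀ n s → isTiling k n s ≡ tilesRectangle n s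
  isTiling≡ n s = trans (all-cong (upTo n) (λ i → all-upTo≡allBelow (λ j → coveredOnce i j s) (k + k))) (all-upTo≡allBelow _ n)

  tilesStrip : ℕ → ℕ → List Tile → Bool
  tilesStrip r n s = allBelow n (λ i → allBelow k (λ j → coveredOnce i (r + j) s))

  vFaultFree≡ : ∀ c s → vFaultFree k c s ≡ noneBelow (λ d → vFault k d s) c
  vFaultFree≡ c s = all-upTo≡allBelow _ c

  module _ {s t : List Tile} (s∼t : SameCounts s t) where

    isTiling-cong : ∀ n → isTiling k n s ≡ isTiling k n t
    isTiling-cong n = trans (isTiling≡ n s) (trans (allBelow-cong n (λ i _ → allBelow-cong (k + k) (λ j _ →
      cong (_≡ᵇ 1) (count-≡ s∼t (covers k i j))))) (sym (isTiling≡ n t)))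

    tilesStrip-cong : ∀ r n → tilesStrip r n s ≡ tilesStrip r n t
    tilesStrip-cong r n = allBelow-cong n (λ i _ → allBelow-cong k (λ j _ → cong (_≡ᵇ 1) (count-≡ s∼t (covers k i (r + j)))))

    hFault-cong : ∀ c → hFault k c s ≡ hFault k c t
    hFault-cong c = cong not (any-sameCounts (meetsHLine k c) s∼t)

    vFault-cong : ∀ c → vFault k c s ≡ vFault k c t
    vFault-cong c = cong not (any-sameCounts (meetsVLine k c) s∼t)

    vFaultFree-cong : ∀ c → vFaultFree k c s ≡ vFaultFree k c t
    vFaultFree-cong c = trans (vFaultFree≡ c s) (trans (allBelow-cong c (λ d _ →
      cong (λ b → not (0 <ᵇ d) ∨ not b) (vFault-cong d))) (sym (vFaultFree≡ c t)))

  module VerticalSplit (c m : ℕ) (s₁ s₃ : List Tile) (s₁-left : All (λ t → x₁ t ≤ c) s₁) where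

    S : List Tile
    S = s₁ ++ map (shift c) s₃

    count-S : ∀ q → count q S ≡ count q s₁ + count (q ∘ shift c) s₃
    count-S q = trans (count-++ q s₁ (map (shift c) s₃)) (cong (count q s₁ +_) (count-map q (shift c) s₃))

    s₃-right : ∀ {d} → d ≤ c → All (λ t → meetsVLine k d t ≡ false) (map (shift c) s₃)
    s₃-right {d} d≤c = All.map (λ {t} c≤x₀ → meetsVLine-false-left {d} t (≤-trans d≤c c≤x₀)) (All-≤x₀-shift c s₃)

    tilesRectangle-S : tilesRectangle (c + m) S ≡ tilesRectangle c s₁ ∧ tilesRectangle m s₃
    tilesRectangle-S = trans (allBelow-+ c m _) (cong₂ _∧_ (allBelow-cong c left) (allBelow-cong m right))
      where
      left : ∀ i → i < c → allBelow (k + k) (λ j → coveredOnce i j S) ≡ allBelow (k + k) (λ j → coveredOnce i j s₁)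
      left i i<c = allBelow-cong (k + k) (λ j _ → cong (_≡ᵇ 1) (trans (count-++ _ s₁ (map (shift c) s₃))
        (trans (cong (count (covers k i j) s₁ +_) (count-none (All.map (λ {t} c≤x₀ → covers-false-left {i} {j} t (<-≤-trans i<c c≤x₀))
          (All-≤x₀-shift c s₃)))) (+-identityʳ _))))
      right : ∀ i → i < m → allBelow (k + k) (λ j → coveredOnce (c + i) j S) ≡ allBelow (k + k) (λ j → coveredOnce i j s₃)
      right i _ = allBelow-cong (k + k) (λ j _ → cong (_≡ᵇ 1) (trans (count-S _) (cong₂ _+_
        (count-none (All.map (λ {t} x₁≤c → covers-false-right {c + i} {j} t (≤-trans x₁≤c (m≤m+n c i))) s₁-left))
        (count-cong s₃ (covers-shift c i j)))))

    hFault-S : hFault k k S ≡ hFault k k s₁ ∧ hFault k k s₃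
    hFault-S rewrite any-++ (meetsHLine k k) s₁ (map (shift c) s₃) | any-map (meetsHLine k k) (shift c) s₃
      | any-cong {p = meetsHLine k k ∘ shift c} s₃ (meetsHLine-shift c k) with any (meetsHLine k k) s₁
    ... | true  = refl
    ... | false = refl

    vFault-S : vFault k c S ≡ true
    vFault-S = cong not (trans (any-++ (meetsVLine k c) s₁ (map (shift c) s₃))
      (cong₂ _∨_ (any-none (All.map (λ {t} → meetsVLine-false-right {c} t) s₁-left)) (any-none (s₃-right ≤-refl))))

    noneBelow-vFault-S : noneBelow (λ d → vFault k d S) c ≡ noneBelow (λ d → vFault k d s₁) c
    noneBelow-vFault-S = allBelow-cong c (λ d d<c → cong (λ b → not (0 <ᵇ d) ∨ not (not b)) (any-S d<c))
      where
      any-S : ∀ {d} → d < c → any (meetsVLine k d) S ≡ any (meetsVLine k d) s₁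
      any-S {d} d<c = trans (any-++ (meetsVLine k d) s₁ (map (shift c) s₃))
        (trans (cong (any (meetsVLine k d) s₁ ∨_) (any-none (s₃-right (<⇒≤ d<c)))) (∨-identityʳ _))

  module HorizontalSplit (n : ℕ) (s₁ s₃ : List Tile)
                         (s₁-below : All (λ t → y₁ t ≤ k) s₁) (s₃-above : All (λ t → k ≤ y₀ t) s₃) where

    tilesRectangle-++ : tilesRectangle n (s₁ ++ s₃) ≡ tilesStrip 0 n s₁ ∧ tilesStrip k n s₃
    tilesRectangle-++ = trans (allBelow-cong n (λ i _ → trans (allBelow-+ k k _)
      (cong₂ _∧_ (allBelow-cong k (lower i)) (allBelow-cong k (upper i))))) (allBelow-∧ n _ _)
      where
      lower : ∀ i j → j < k → coveredOnce i j (s₁ ++ s₃) ≡ coveredOnce i j s₁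
      lower i j j<k = cong (_≡ᵇ 1) (trans (count-++ _ s₁ s₃) (trans (cong (count (covers k i j) s₁ +_)
        (count-none (All.map (λ {t} k≤y₀ → covers-false-below {i} {j} t (<-≤-trans j<k k≤y₀)) s₃-above))) (+-identityʳ _)))
      upper : ∀ i j → j < k → coveredOnce i (k + j) (s₁ ++ s₃) ≡ coveredOnce i (k + j) s₃
      upper i j _ = cong (_≡ᵇ 1) (trans (count-++ _ s₁ s₃) (cong (_+ count (covers k i (k + j)) s₃)
        (count-none (All.map (λ {t} y₁≤k → covers-false-above {i} {k + j} t (≤-trans y₁≤k (m≤m+n k j))) s₁-below))))

    hFault-++ : hFault k k (s₁ ++ s₃) ≡ true
    hFault-++ = cong not (trans (any-++ (meetsHLine k k) s₁ s₃)
      (cong₂ _∨_ (any-none (All.map (λ {t} → meetsHLine-false-above {k} t) s₁-below))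
                 (any-none (All.map (λ {t} → meetsHLine-false-below {k} t) s₃-above))))

  vFault-crossing : ∀ {c} x → x₀ x < c → c < x₁ x → ∀ s t → vFault k c (s ++ x ∷ t) ≡ false
  vFault-crossing x x₀<c c<x₁ s t = cong not (any-++-∷ (meetsVLine k _) s x t (meetsVLine-true x x₀<c c<x₁))

  hFault-crossing : ∀ {c} x → y₀ x < c → c < y₁ x → ∀ s t → hFault k c (s ++ x ∷ t) ≡ false
  hFault-crossing x y₀<c c<y₁ s t = cong not (any-++-∷ (meetsHLine k _) s x t (meetsHLine-true x y₀<c c<y₁))

  tilesStrip-false : ∀ r n s i j → i < n → j < k → coveredOnce i (r + j) s ≡ false → tilesStrip r n s ≡ false
  tilesStrip-false r n s i j i<n j<k e = allBelow-false n _ i i<n (allBelow-false k _ j j<k e)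

  row-of-strip : ∀ r y → r ≤ y → y < r + k → Σ ℕ (λ j → (r + j ≡ y) × (j < k))
  row-of-strip r y r≤y y<r+k =
    y ∸ r , m+[n∸m]≡n r≤y , +-cancelˡ-< r (y ∸ r) k (subst (_< r + k) (sym (m+[n∸m]≡n r≤y)) y<r+k)

  first-column-uncovered : ∀ r m s t j → All (λ u → 1 ≤ x₀ u) s → j < k → count (covers k 0 (r + j)) t ≡ 0 →
                           tilesStrip r (suc m) (s ++ t) ≡ false
  first-column-uncovered r m s t j s-right j<k t-misses = tilesStrip-false r (suc m) (s ++ t) 0 j (s≤s z≤n) j<k
    (cong (_≡ᵇ 1) (trans (count-++ (covers k 0 (r + j)) s t)
      (cong₂ _+_ (count-none (All.map (λ {u} → covers-false-left {0} {r + j} u) s-right)) t-misses)))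

  IsStackTile : ℕ → ℕ → Tile → Set
  IsStackTile r j x = (x₀ x ≡ 0) × (x₁ x ≡ k) × (isVert x ≡ false) × (r ≤ y₀ x) × (y₀ x < r + j) × (y₁ x ≡ suc (y₀ x))

  All-IsStackTile : ∀ r j → All (IsStackTile r j) (horizontalStack r j)
  All-IsStackTile r zero    = []
  All-IsStackTile r (suc j) = ++⁺
    (All.map (λ (a , b , c , d , e , f) → a , b , c , d , ≤-trans e (+-monoʳ-≤ r (n≤1+n j)) , f) (All-IsStackTile r j))
    ((refl , refl , refl , m≤m+n r j , subst (_≤ r + suc j) (+-suc r j) ≤-refl , refl) ∷ [])

  length-horizontalStack : ∀ r j → length (horizontalStack r j) ≡ j
  length-horizontalStack r zero    = refl
  length-horizontalStack r (suc j) rewrite length-++ (horizontalStack r j) {horiz 0 (r + j) ∷ []}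
    | length-horizontalStack r j = +-comm j 1

  count-covers-horizontalStack : ∀ r i j j′ → i < k →
    count (covers k i (r + j)) (horizontalStack r j′) ≡ (if j <ᵇ j′ then 1 else 0)
  count-covers-horizontalStack r i j zero    i<k = refl
  count-covers-horizontalStack r i j (suc j′) i<k
    rewrite count-++ (covers k i (r + j)) (horizontalStack r j′) (horiz 0 (r + j′) ∷ [])
          | count-covers-horizontalStack r i j j′ i<k with <-cmp j j′
  ... | tri< j<j′ _ _ rewrite <ᵇ-true j<j′ | <ᵇ-true (m<n⇒m<1+n j<j′)
    | covers-false-below {i} {r + j} (horiz 0 (r + j′)) (+-monoʳ-< r j<j′) = refl
  ... | tri≈ _ refl _ rewrite <ᵇ-false (≤-refl {j}) | <ᵇ-true (n<1+n j)
    | covers-true {i} {r + j} (horiz 0 (r + j)) z≤n i<k ≤-refl (n<1+n (r + j)) = refl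
  ... | tri> _ _ j>j′ rewrite <ᵇ-false (<⇒≤ j>j′) | <ᵇ-false j>j′
    | covers-false-above {i} {r + j} (horiz 0 (r + j′)) (subst (_≤ r + j) (+-suc r j′) (+-monoʳ-≤ r j>j′)) = refl

  count-covers-fullStack : ∀ r i j → i < k → j < k → count (covers k i (r + j)) (horizontalStack r k) ≡ 1
  count-covers-fullStack r i j i<k j<k rewrite count-covers-horizontalStack r i j k i<k | <ᵇ-true j<k = refl

  count-covers-right-of-stack : ∀ r i j → k ≤ i → count (covers k i j) (horizontalStack r k) ≡ 0
  count-covers-right-of-stack r i j k≤i =
    count-none (All.map (λ {x} (_ , x₁≡k , _) → covers-false-right x (subst (_≤ i) (sym x₁≡k) k≤i)) (All-IsStackTile r k))

  module VerticalFirst (r m : ℕ) where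

    S : List Tile → List Tile
    S s = map (shift 1) s ++ vert 0 r ∷ []

    tilesStrip-S : ∀ s → tilesStrip r (suc m) (S s) ≡ tilesStrip r m s
    tilesStrip-S s = trans (allBelow-+ 1 m _) (cong₂ _∧_ firstColumn-ok (allBelow-cong m rest))
      where
      count-S : ∀ q → count q (S s) ≡ count (q ∘ shift 1) s + count q (vert 0 r ∷ [])
      count-S q = trans (count-++ q (map (shift 1) s) _) (cong (_+ count q (vert 0 r ∷ [])) (count-map q (shift 1) s))
      firstColumn-ok : allBelow 1 (λ i → allBelow k (λ j → coveredOnce i (r + j) (S s))) ≡ true
      firstColumn-ok = allBelow-true k _ (λ j j<k → cong (_≡ᵇ 1) (trans (count-S (covers k 0 (r + j)))
        (cong₂ _+_ (count-none (universal shifted-misses s)) (cong (λ b → if b then 1 else 0) (vertical-covers j<k)))))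
        where
        shifted-misses : ∀ {j} t → covers k 0 (r + j) (shift 1 t) ≡ false
        shifted-misses t = covers-false-left (shift 1 t) (subst (0 <_) (sym (x₀-shift 1 t)) (s≤s z≤n))
        vertical-covers : ∀ {j} → j < k → covers k 0 (r + j) (vert 0 r) ≡ true
        vertical-covers j<k = covers-true (vert 0 r) z≤n (s≤s z≤n) (m≤m+n r _) (+-monoʳ-< r j<k)
      rest : ∀ i → i < m → allBelow k (λ j → coveredOnce (1 + i) (r + j) (S s)) ≡ allBelow k (λ j → coveredOnce i (r + j) s)
      rest i _ = allBelow-cong k (λ j _ → cong (_≡ᵇ 1) (trans (count-S (covers k (1 + i) (r + j)))
        (trans (cong₂ _+_ (count-cong s (covers-shift 1 i (r + j)))
                          (cong (λ b → if b then 1 else 0) (covers-false-right {1 + i} {r + j} (vert 0 r) (s≤s z≤n))))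
               (+-identityʳ _))))

    vertical-blocks-stack : ∀ x → IsStackTile r k x → ∀ s t → tilesStrip r (suc m) (s ++ vert 0 r ∷ x ∷ t) ≡ false
    vertical-blocks-stack x (x₀≡0 , x₁≡k , _ , r≤y₀ , y₀<r+k , y₁≡1+y₀) s t with row-of-strip r (y₀ x) r≤y₀ y₀<r+k
    ... | j , r+j≡y₀ , j<k = tilesStrip-false r (suc m) (s ++ vert 0 r ∷ x ∷ t) 0 j (s≤s z≤n) j<k (≡ᵇ1-false
      (count-++-∷-∷-≥2 (covers k 0 (r + j)) s (vert 0 r) x t
        (covers-true (vert 0 r) z≤n (s≤s z≤n) (m≤m+n r j) (+-monoʳ-< r j<k))
        (covers-true x (≤-reflexive x₀≡0) (subst (0 <_) (sym x₁≡k) 1≤k) (≤-reflexive (sym r+j≡y₀))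
          (subst (r + j <_) (sym y₁≡1+y₀) (subst (_< suc (y₀ x)) (sym r+j≡y₀) (n<1+n _))))))

  module HorizontalFirst (r m : ℕ) where

    S : List Tile → List Tile
    S s = map (shift k) s ++ horizontalStack r k

    count-S : ∀ q s → count q (S s) ≡ count (q ∘ shift k) s + count q (horizontalStack r k)
    count-S q s = trans (count-++ q (map (shift k) s) _) (cong (_+ count q (horizontalStack r k)) (count-map q (shift k) s))

    tilesStrip-S : ∀ s → tilesStrip r (k + m) (S s) ≡ tilesStrip r m s
    tilesStrip-S s = trans (allBelow-+ k m _) (cong₂ _∧_ stack-ok (allBelow-cong m rest))
      where
      stack-ok : allBelow k (λ i → allBelow k (λ j → coveredOnce i (r + j) (S s))) ≡ true
      stack-ok = allBelow-true k _ (λ i i<k → allBelow-true k _ (λ j j<k → cong (_≡ᵇ 1)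
        (trans (count-S (covers k i (r + j)) s)
               (cong₂ _+_ (count-none (universal (shifted-misses i<k) s)) (count-covers-fullStack r i j i<k j<k)))))
        where
        shifted-misses : ∀ {i j} → i < k → ∀ t → covers k i j (shift k t) ≡ false
        shifted-misses {i} i<k t = covers-false-left (shift k t) (subst (i <_) (sym (x₀-shift k t)) (≤-trans i<k (m≤m+n k (x₀ t))))
      rest : ∀ i → i < m → allBelow k (λ j → coveredOnce (k + i) (r + j) (S s)) ≡ allBelow k (λ j → coveredOnce i (r + j) s)
      rest i _ = allBelow-cong k (λ j _ → cong (_≡ᵇ 1) (trans (count-S (covers k (k + i) (r + j)) s)
        (trans (cong₂ _+_ (count-cong s (covers-shift k i (r + j))) (count-covers-right-of-stack r (k + i) (r + j) (m≤m+n k i)))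
               (+-identityʳ _))))

    stack-blocks-x₀<k : ∀ x → x₀ x < k → inStrip r x ≡ true →
                         ∀ s t → tilesStrip r (k + m) ((s ++ x ∷ t) ++ horizontalStack r k) ≡ false
    stack-blocks-x₀<k x x₀<k x-in s t
      with row-of-strip r (y₀ x) (≤ᵇ-true⇒≤ (∧-conicalˡ _ _ x-in)) (<-≤-trans (y₀<y₁ x) (≤ᵇ-true⇒≤ (∧-conicalʳ _ _ x-in)))
    ... | j , r+j≡y₀ , j<k =
      tilesStrip-false r (k + m) ((s ++ x ∷ t) ++ horizontalStack r k) (x₀ x) j (≤-trans x₀<k (m≤m+n k m)) j<k (≡ᵇ1-false twice)
      where
      q : Tile → Bool
      q = covers k (x₀ x) (r + j)
      once : 1 ≤ count q (s ++ x ∷ t)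
      once = count-++-∷-≥1 q s x t
        (covers-true x ≤-refl (x₀<x₁ x) (≤-reflexive (sym r+j≡y₀)) (subst (_< y₁ x) (sym r+j≡y₀) (y₀<y₁ x)))
      twice : 2 ≤ count q ((s ++ x ∷ t) ++ horizontalStack r k)
      twice rewrite count-++ q (s ++ x ∷ t) (horizontalStack r k) | count-covers-fullStack r (x₀ x) j x₀<k j<k =
        subst (2 ≤_) (+-comm 1 _) (s≤s once)

module SeriesAlgebra {c ℓ} (R : CommutativeRing c ℓ) where
  open CommutativeRing R renaming (_+_ to _+ᴿ_; _*_ to _*ᴿ_)
  open WithRing R
  open RingProperties ring using (x[y-z]≈xy-xz; [y-z]x≈yx-zx)
  open import Algebra.Properties.AbelianGroup +-abelianGroup using (⁻¹-∙-comm; ε⁻¹≈ε)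
  open import Relation.Binary.Reasoning.Setoid setoid

  guard : Bool → Carrier → Carrier
  guard b x = if b then x else 0#

  guard-∧ : ∀ b₁ b₂ x y → guard (b₁ ∧ b₂) (x *ᴿ y) ≈ guard b₁ x *ᴿ guard b₂ y
  guard-∧ true  true  x y = refl
  guard-∧ true  false x y = sym (zeroʳ x)
  guard-∧ false b₂    x y = sym (zeroˡ _)

  guard-cong : ∀ b {x y} → x ≈ y → guard b x ≈ guard b y
  guard-cong true  x≈y = x≈y
  guard-cong false x≈y = refl

  guard-false : ∀ {b} x → b ≡ false → guard b x ≈ 0#
  guard-false x ≡.refl = refl

  guard-*ˡ : ∀ b x y → guard b (x *ᴿ y) ≈ x *ᴿ guard b y
  guard-*ˡ true  x y = refl
  guard-*ˡ false x y = sym (zeroʳ x)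

  pow-+ : ∀ x m n → pow x (m + n) ≈ pow x m *ᴿ pow x n
  pow-+ x zero    n = sym (*-identityˡ _)
  pow-+ x (suc m) n = trans (*-congˡ (pow-+ x m n)) (sym (*-assoc _ _ _))

  sumTo-cong : ∀ n {f g : ℕ → Carrier} → (∀ i → i < n → f i ≈ g i) → sumTo n f ≈ sumTo n g
  sumTo-cong zero    f≈g = refl
  sumTo-cong (suc n) f≈g = +-cong (sumTo-cong n (λ i i<n → f≈g i (ℕₚ.m<n⇒m<1+n i<n))) (f≈g n ℕₚ.≤-refl)

  sumTo-zero : ∀ n {f : ℕ → Carrier} → (∀ i → i < n → f i ≈ 0#) → sumTo n f ≈ 0#
  sumTo-zero n f≈0 = trans (sumTo-cong n f≈0) (zeros n)
    where
    zeros : ∀ n → sumTo n (λ _ → 0#) ≈ 0#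
    zeros zero    = refl
    zeros (suc n) = trans (+-identityʳ _) (zeros n)

  sumTo-+ : ∀ n (f g : ℕ → Carrier) → sumTo n (λ i → f i +ᴿ g i) ≈ sumTo n f +ᴿ sumTo n g
  sumTo-+ zero    f g = sym (+-identityˡ 0#)
  sumTo-+ (suc n) f g =
    trans (+-congʳ (sumTo-+ n f g)) (CommSemigroupProperties.interchange +-commutativeSemigroup _ _ _ _)

  sumTo-neg : ∀ n (f : ℕ → Carrier) → sumTo n (λ i → - f i) ≈ - sumTo n f
  sumTo-neg zero    f = sym ε⁻¹≈ε
  sumTo-neg (suc n) f = trans (+-congʳ (sumTo-neg n f)) (⁻¹-∙-comm _ _)

  sumTo-− : ∀ n (f g : ℕ → Carrier) → sumTo n (λ i → f i - g i) ≈ sumTo n f - sumTo n g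
  sumTo-− n f g = trans (sumTo-+ n f (λ i → - g i)) (+-congˡ (sumTo-neg n g))

  sumTo-first : ∀ n (f : ℕ → Carrier) → sumTo (suc n) f ≈ f 0 +ᴿ sumTo n (f ∘ suc)
  sumTo-first zero    f = trans (+-identityˡ _) (sym (+-identityʳ _))
  sumTo-first (suc n) f = trans (+-congʳ (sumTo-first n f)) (+-assoc _ _ _)

  sumTo-reverse : ∀ n (f : ℕ → Carrier) → sumTo n f ≈ sumTo n (λ i → f (n ∸ suc i))
  sumTo-reverse zero    f = refl
  sumTo-reverse (suc n) f = begin
    sumTo n f +ᴿ f n                            ≈⟨ +-comm _ _ ⟩
    f n +ᴿ sumTo n f                            ≈⟨ +-congˡ (sumTo-reverse n f) ⟩
    f n +ᴿ sumTo n (λ i → f (n ∸ suc i))        ≈⟨ sumTo-first n (λ i → f (n ∸ i)) ⟨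
    sumTo (suc n) (λ i → f (n ∸ i))             ∎

  sumTo-mono : ∀ a m N (f : ℕ → Carrier) → sumTo N (λ i → mono a m i *ᴿ f i) ≈ guard (m <ᵇ N) (a *ᴿ f m)
  sumTo-mono a m zero    f = refl
  sumTo-mono a m (suc N) f with ℕₚ.<-cmp m N
  ... | tri< m<N _ _ rewrite ≡ᵇ-false (ℕₚ.>⇒≢ m<N) | <ᵇ-true (ℕₚ.m<n⇒m<1+n m<N) =
    trans (+-cong (trans (sumTo-mono a m N f) (reflexive (≡.cong (λ b → guard b (a *ᴿ f m)) (<ᵇ-true m<N)))) (zeroˡ _))
          (+-identityʳ _)
  ... | tri≈ _ ≡.refl _ rewrite ≡ᵇ-refl m | <ᵇ-true (ℕₚ.n<1+n m) =
    trans (+-congʳ (trans (sumTo-mono a m m f) (reflexive (≡.cong (λ b → guard b (a *ᴿ f m)) (<ᵇ-false (ℕₚ.≤-refl {m}))))))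
          (+-identityˡ _)
  ... | tri> _ _ m>N rewrite ≡ᵇ-false (ℕₚ.<⇒≢ m>N) | <ᵇ-false m>N =
    trans (+-congʳ (trans (sumTo-mono a m N f) (reflexive (≡.cong (λ b → guard b (a *ᴿ f m)) (<ᵇ-false (ℕₚ.<⇒≤ m>N))))))
          (trans (+-identityˡ _) (zeroˡ _))

  ⊛-comm : ∀ f g n → (f ⊛ g) n ≈ (g ⊛ f) n
  ⊛-comm f g n = trans (sumTo-reverse (suc n) (λ i → f i *ᴿ g (n ∸ i))) (sumTo-cong (suc n) swap)
    where
    swap : ∀ i → i < suc n → f (n ∸ i) *ᴿ g (n ∸ (n ∸ i)) ≈ g i *ᴿ f (n ∸ i)
    swap i (s≤s i≤n) = trans (*-comm _ _) (reflexive (≡.cong (λ j → g j *ᴿ f (n ∸ i)) (ℕₚ.m∸[m∸n]≡n i≤n)))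

  mono-⊛ : ∀ a m g n → (mono a m ⊛ g) n ≈ guard (m ≤ᵇ n) (a *ᴿ g (n ∸ m))
  mono-⊛ a m g n =
    trans (sumTo-mono a m (suc n) (λ i → g (n ∸ i))) (reflexive (≡.cong (λ b → guard b (a *ᴿ g (n ∸ m))) (<ᵇ-suc m n)))

  oneₛ-⊛ : ∀ f → (oneₛ ⊛ f) ≈ₛ f
  oneₛ-⊛ f n = trans (mono-⊛ 1# 0 f n) (*-identityˡ (f n))

  ⊛-oneₛ : ∀ f → (f ⊛ oneₛ) ≈ₛ f
  ⊛-oneₛ f n = trans (⊛-comm f oneₛ n) (oneₛ-⊛ f n)

  ⊛-−ₛ : ∀ f g h n → (f ⊛ (g −ₛ h)) n ≈ (f ⊛ g) n - (f ⊛ h) n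
  ⊛-−ₛ f g h n = trans (sumTo-cong (suc n) (λ i _ → x[y-z]≈xy-xz (f i) (g (n ∸ i)) (h (n ∸ i)))) (sumTo-− (suc n) _ _)

  −ₛ-⊛ : ∀ f g h n → ((f −ₛ g) ⊛ h) n ≈ (f ⊛ h) n - (g ⊛ h) n
  −ₛ-⊛ f g h n = trans (sumTo-cong (suc n) (λ i _ → [y-z]x≈yx-zx (h (n ∸ i)) (f i) (g i))) (sumTo-− (suc n) _ _)

  x-y≈z⇒x≈z+y : ∀ {x y z} → x - y ≈ z → x ≈ z +ᴿ y
  x-y≈z⇒x≈z+y {x} {y} {z} x-y≈z = begin
    x                     ≈⟨ +-identityʳ x ⟨
    x +ᴿ 0#               ≈⟨ +-congˡ (-‿inverseˡ y) ⟨
    x +ᴿ (- y +ᴿ y)       ≈⟨ +-assoc x (- y) y ⟨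
    (x - y) +ᴿ y          ≈⟨ +-congʳ x-y≈z ⟩
    z +ᴿ y                ∎

  x≈y+z⇒x-z≈y : ∀ {x y z} → x ≈ y +ᴿ z → x - z ≈ y
  x≈y+z⇒x-z≈y {x} {y} {z} x≈y+z = begin
    x - z                 ≈⟨ +-congʳ x≈y+z ⟩
    (y +ᴿ z) - z          ≈⟨ +-assoc y z (- z) ⟩
    y +ᴿ (z - z)          ≈⟨ +-congˡ (-‿inverseʳ z) ⟩
    y +ᴿ 0#               ≈⟨ +-identityʳ y ⟩
    y                     ∎

  sumTo-firstTrue : ∀ φ m x → φ (suc m) ≡ true → sumTo (suc m) (λ i → guard (φ (suc i) ∧ noneBelow φ (suc i)) x) ≈ x
  sumTo-firstTrue φ m x φ[1+m] = trans (+-congˡ (reflexive (≡.cong (λ b → guard (b ∧ noneBelow φ (suc m)) x) φ[1+m])))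
                                       (telescope m)
    where
    F : ℕ → Carrier
    F i = guard (φ (suc i) ∧ noneBelow φ (suc i)) x
    split : ∀ p q → guard (p ∧ q) x +ᴿ guard (q ∧ not p) x ≈ guard q x
    split true  true  = +-identityʳ x
    split true  false = +-identityʳ 0#
    split false true  = +-identityˡ x
    split false false = +-identityˡ 0#
    telescope : ∀ m → sumTo m F +ᴿ guard (noneBelow φ (suc m)) x ≈ x
    telescope zero    = +-identityˡ x
    telescope (suc m) = begin
      (sumTo m F +ᴿ F m) +ᴿ guard (noneBelow φ (suc m) ∧ not (φ (suc m))) x
        ≈⟨ +-assoc _ _ _ ⟩
      sumTo m F +ᴿ (F m +ᴿ guard (noneBelow φ (suc m) ∧ not (φ (suc m))) x)
        ≈⟨ +-congˡ (split (φ (suc m)) (noneBelow φ (suc m))) ⟩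
      sumTo m F +ᴿ guard (noneBelow φ (suc m)) x
        ≈⟨ telescope m ⟩
      x ∎

  SatisfiesRecurrence : ℕ → Carrier → Carrier → Series → Set ℓ
  SatisfiesRecurrence k a b X =
    (X 0 ≈ 1#) × (∀ m → X (suc m) ≈ a *ᴿ X m +ᴿ guard (k ≤ᵇ suc m) (b *ᴿ X (suc m ∸ k)))

  satisfiesRecurrence-unique : ∀ {k a b X Y} → 1 ≤ k →
    SatisfiesRecurrence k a b X → SatisfiesRecurrence k a b Y → X ≈ₛ Y
  satisfiesRecurrence-unique {k} {a} {b} {X} {Y} 1≤k (X₀ , Xₛ) (Y₀ , Yₛ) n = below n n ℕₚ.≤-refl
    where
    below : ∀ n i → i ≤ n → X i ≈ Y i
    below n       zero    _         = trans X₀ (sym Y₀)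
    below (suc n) (suc i) (s≤s i≤n) = begin
      X (suc i)
        ≈⟨ Xₛ i ⟩
      a *ᴿ X i +ᴿ guard (k ≤ᵇ suc i) (b *ᴿ X (suc i ∸ k))
        ≈⟨ +-cong (*-congˡ (below n i i≤n))
                  (guard-cong (k ≤ᵇ suc i) (*-congˡ (below n (suc i ∸ k) (ℕₚ.≤-trans (ℕₚ.∸-monoʳ-≤ (suc i) 1≤k) i≤n)))) ⟩
      a *ᴿ Y i +ᴿ guard (k ≤ᵇ suc i) (b *ᴿ Y (suc i ∸ k))
        ≈⟨ Yₛ i ⟨
      Y (suc i) ∎

  inverse-satisfiesRecurrence : ∀ {k a b} G → 1 ≤ k → (p k a b ⊛ G) ≈ₛ oneₛ → SatisfiesRecurrence k a b G
  inverse-satisfiesRecurrence {k} {a} {b} G 1≤k pG≈1 = initial , step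
    where
    expand : ∀ n → (p k a b ⊛ G) n ≈ (G n - guard (1 ≤ᵇ n) (a *ᴿ G (n ∸ 1))) - guard (k ≤ᵇ n) (b *ᴿ G (n ∸ k))
    expand n = begin
      (p k a b ⊛ G) n
        ≈⟨ −ₛ-⊛ (oneₛ −ₛ mono a 1) (mono b k) G n ⟩
      ((oneₛ −ₛ mono a 1) ⊛ G) n - (mono b k ⊛ G) n
        ≈⟨ +-cong (−ₛ-⊛ oneₛ (mono a 1) G n) (-‿cong (mono-⊛ b k G n)) ⟩
      ((oneₛ ⊛ G) n - (mono a 1 ⊛ G) n) - guard (k ≤ᵇ n) (b *ᴿ G (n ∸ k))
        ≈⟨ +-congʳ (+-cong (oneₛ-⊛ G n) (-‿cong (mono-⊛ a 1 G n))) ⟩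
      (G n - guard (1 ≤ᵇ n) (a *ᴿ G (n ∸ 1))) - guard (k ≤ᵇ n) (b *ᴿ G (n ∸ k)) ∎
    solve : ∀ n → G n ≈ oneₛ n +ᴿ (guard (1 ≤ᵇ n) (a *ᴿ G (n ∸ 1)) +ᴿ guard (k ≤ᵇ n) (b *ᴿ G (n ∸ k)))
    solve n = trans (x-y≈z⇒x≈z+y (x-y≈z⇒x≈z+y (trans (sym (expand n)) (pG≈1 n))))
                    (trans (+-assoc _ _ _) (+-congˡ (+-comm _ _)))
    initial : G 0 ≈ 1#
    initial = trans (solve 0) (trans (+-congˡ (trans (+-identityˡ _) (guard-false _ (≤ᵇ-false 1≤k)))) (+-identityʳ 1#))
    step : ∀ m → G (suc m) ≈ a *ᴿ G m +ᴿ guard (k ≤ᵇ suc m) (b *ᴿ G (suc m ∸ k))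
    step m = trans (solve (suc m)) (+-identityˡ _)

module TilingSums {c ℓ} (R : CommutativeRing c ℓ) (k : ℕ) (1≤k : 1 ≤ k) (a b : CommutativeRing.Carrier R) where
  open CommutativeRing R renaming (_+_ to _+ᴿ_; _*_ to _*ᴿ_)
  open WithRing R
  open SublistSums semiring
  open SeriesAlgebra R
  open TileGeometry k 1≤k
  open CommSemigroupProperties *-commutativeSemigroup using (interchange)
  open import Relation.Binary.Reasoning.Setoid setoid

  #vert #horiz : List Tile → ℕ
  #vert  = count isVert
  #horiz = count (not ∘ isVert)

  w : List Tile → Carrier
  w = weight a b k

  weight-cong : ∀ {s t} → SameCounts s t → w s ≡ w t
  weight-cong s∼t = ≡.cong₂ (λ m n → pow a m *ᴿ pow b n) (count-≡ s∼t isVert) (count-≡ s∼t (not ∘ isVert))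

  weight-shift : ∀ c s → w (map (shift c) s) ≡ w s
  weight-shift c s = ≡.cong₂ (λ m n → pow a m *ᴿ pow b n)
    (≡.trans (count-map isVert (shift c) s) (count-cong s (isVert-shift c)))
    (≡.trans (count-map (not ∘ isVert) (shift c) s) (count-cong s (≡.cong not ∘ isVert-shift c)))

  weight-++ : ∀ s t → w (s ++ t) ≈ w s *ᴿ w t
  weight-++ s t = begin
    pow a (#vert (s ++ t)) *ᴿ pow b (#horiz (s ++ t))
      ≡⟨ ≡.cong₂ (λ m n → pow a m *ᴿ pow b n) (count-++ isVert s t) (count-++ (not ∘ isVert) s t) ⟩
    pow a (#vert s + #vert t) *ᴿ pow b (#horiz s + #horiz t)
      ≈⟨ *-cong (pow-+ a (#vert s) (#vert t)) (pow-+ b (#horiz s) (#horiz t)) ⟩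
    (pow a (#vert s) *ᴿ pow a (#vert t)) *ᴿ (pow b (#horiz s) *ᴿ pow b (#horiz t))
      ≈⟨ interchange _ _ _ _ ⟩
    w s *ᴿ w t ∎

  weight-vertical : ∀ x y → w (vert x y ∷ []) ≈ a
  weight-vertical x y = trans (*-identityʳ _) (*-identityʳ a)

  weight-horizontalStack : ∀ r → w (horizontalStack r k) ≈ pow b k
  weight-horizontalStack r = trans (reflexive (≡.cong₂ (λ m n → pow a m *ᴿ pow b n) noVertical allHorizontal)) (*-identityˡ _)
    where
    noVertical : #vert (horizontalStack r k) ≡ 0
    noVertical = count-none (All.map (λ (_ , _ , isHoriz , _) → isHoriz) (All-IsStackTile r k))
    allHorizontal : #horiz (horizontalStack r k) ≡ k
    allHorizontal = ≡.trans (count-all (All.map (λ (_ , _ , isHoriz , _) → ≡.cong not isHoriz) (All-IsStackTile r k)))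
                            (length-horizontalStack r k)

  totalWeight-filterᵇ : ∀ (Q : List Tile → Bool) tss →
                        totalWeight a b k (filterᵇ Q tss) ≈ listSum (map (λ s → guard (Q s) (w s)) tss)
  totalWeight-filterᵇ Q []        = refl
  totalWeight-filterᵇ Q (s ∷ tss) with Q s
  ... | true  = +-congˡ (totalWeight-filterᵇ Q tss)
  ... | false = trans (totalWeight-filterᵇ Q tss) (sym (+-identityˡ _))

  All-inside : ∀ n → All (λ t → inside k n t ≡ true) (placements k n)
  All-inside n = All-filterᵇ (inside k n) (concatMap column (upTo n))

  inside⇒x₁≤ : ∀ {n} t → inside k n t ≡ true → x₁ t ≤ n
  inside⇒x₁≤ {n} t e = ≤ᵇ-true⇒≤ (∧-conicalˡ _ _ (≡.trans (≡.sym (inside≡ n t)) e))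

  inside⇒y₁≤ : ∀ {n} t → inside k n t ≡ true → y₁ t ≤ k + k
  inside⇒y₁≤ {n} t e = ≤ᵇ-true⇒≤ (∧-conicalʳ _ _ (≡.trans (≡.sym (inside≡ n t)) e))

  inStrip⇒ : ∀ r t → inStrip r t ≡ true → (r ≤ y₀ t) × (y₁ t ≤ r + k)
  inStrip⇒ r t e = ≤ᵇ-true⇒≤ (∧-conicalˡ _ _ e) , ≤ᵇ-true⇒≤ (∧-conicalʳ _ _ e)

  hSummand : ℕ → List Tile → Carrier
  hSummand n s = guard (isTiling k n s ∧ hFault k k s) (w s)

  vSummand : ℕ → List Tile → Carrier
  vSummand n s = guard (isTiling k n s ∧ hFault k k s ∧ vFaultFree k n s) (w s)

  firstFaultSummand : ℕ → ℕ → List Tile → Carrier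
  firstFaultSummand n c s = guard (isTiling k n s ∧ hFault k k s ∧ (vFault k c s ∧ vFaultFree k c s)) (w s)

  stripSummand : ℕ → ℕ → List Tile → Carrier
  stripSummand r n s = guard (tilesStrip r n s) (w s)

  stripWeight : ℕ → Series
  stripWeight r n = sublistSum (stripPlacements r n) (stripSummand r n)

  h≈sublistSum : ∀ n → h a b k n ≈ sublistSum (placements k n) (hSummand n)
  h≈sublistSum n = totalWeight-filterᵇ _ (sublists (placements k n))

  v≈sublistSum : ∀ n → v a b k n ≈ sublistSum (placements k n) (vSummand n)
  v≈sublistSum n = totalWeight-filterᵇ _ (sublists (placements k n))

  hSummand-cong : ∀ n {s t} → SameCounts s t → hSummand n s ≈ hSummand n t
  hSummand-cong n s∼t = reflexive (≡.cong₂ guard (≡.cong₂ _∧_ (isTiling-cong s∼t n) (hFault-cong s∼t k)) (weight-cong s∼t))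

  firstFaultSummand-cong : ∀ n c {s t} → SameCounts s t → firstFaultSummand n c s ≈ firstFaultSummand n c t
  firstFaultSummand-cong n c s∼t = reflexive (≡.cong₂ guard
    (≡.cong₂ _∧_ (isTiling-cong s∼t n)
      (≡.cong₂ _∧_ (hFault-cong s∼t k) (≡.cong₂ _∧_ (vFault-cong s∼t c) (vFaultFree-cong s∼t c))))
    (weight-cong s∼t))

  stripSummand-cong : ∀ r n {s t} → SameCounts s t → stripSummand r n s ≈ stripSummand r n t
  stripSummand-cong r n s∼t = reflexive (≡.cong₂ guard (tilesStrip-cong s∼t r n) (weight-cong s∼t))

  hSummand-vanish : ∀ n s → hFault k k s ≡ false → hSummand n s ≈ 0#
  hSummand-vanish n s noFault = guard-false (w s) (≡.trans (≡.cong (isTiling k n s ∧_) noFault) (∧-zeroʳ _))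

  firstFaultSummand-vanish : ∀ n c s → vFault k c s ≡ false → firstFaultSummand n c s ≈ 0#
  firstFaultSummand-vanish n c s noFault rewrite noFault =
    guard-false (w s) (≡.trans (≡.cong (isTiling k n s ∧_) (∧-zeroʳ (hFault k k s))) (∧-zeroʳ (isTiling k n s)))

  firstFaultSummand-split : ∀ c m s₁ s₃ → All (λ t → x₁ t ≤ c) s₁ →
                            firstFaultSummand (c + m) c (s₁ ++ map (shift c) s₃) ≈ vSummand c s₁ *ᴿ hSummand m s₃
  firstFaultSummand-split c m s₁ s₃ s₁-left = begin
    firstFaultSummand (c + m) c S   ≡⟨ ≡.cong₂ guard conditions (≡.refl {x = w S}) ⟩
    guard (B₁ ∧ B₃) (w S)           ≈⟨ guard-cong (B₁ ∧ B₃) (trans (weight-++ s₁ _) (*-congˡ (reflexive (weight-shift c s₃)))) ⟩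
    guard (B₁ ∧ B₃) (w s₁ *ᴿ w s₃)  ≈⟨ guard-∧ B₁ B₃ (w s₁) (w s₃) ⟩
    vSummand c s₁ *ᴿ hSummand m s₃  ∎
    where
    open VerticalSplit c m s₁ s₃ s₁-left
    B₁ B₃ : Bool
    B₁ = isTiling k c s₁ ∧ (hFault k k s₁ ∧ vFaultFree k c s₁)
    B₃ = isTiling k m s₃ ∧ hFault k k s₃
    rearrange : ∀ t₁ t₃ h₁ h₃ f₁ → (t₁ ∧ t₃) ∧ ((h₁ ∧ h₃) ∧ (true ∧ f₁)) ≡ (t₁ ∧ (h₁ ∧ f₁)) ∧ (t₃ ∧ h₃)
    rearrange true  true  true  true  f₁ = ≡.sym (∧-identityʳ f₁)
    rearrange true  true  true  false f₁ = ≡.sym (∧-zeroʳ f₁)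
    rearrange true  true  false h₃    f₁ = ≡.refl
    rearrange true  false h₁    h₃    f₁ = ≡.sym (∧-zeroʳ _)
    rearrange false t₃    h₁    h₃    f₁ = ≡.refl
    conditions : (isTiling k (c + m) S ∧ hFault k k S ∧ (vFault k c S ∧ vFaultFree k c S)) ≡ (B₁ ∧ B₃)
    conditions = ≡.trans
      (≡.cong₂ _∧_
        (≡.trans (isTiling≡ (c + m) S) (≡.trans tilesRectangle-S (≡.sym (≡.cong₂ _∧_ (isTiling≡ c s₁) (isTiling≡ m s₃)))))
        (≡.cong₂ _∧_ hFault-S (≡.cong₂ _∧_ vFault-S
          (≡.trans (vFaultFree≡ c S) (≡.trans noneBelow-vFault-S (≡.sym (vFaultFree≡ c s₁)))))))
      (rearrange (isTiling k c s₁) (isTiling k m s₃) (hFault k k s₁) (hFault k k s₃) (vFaultFree k c s₁))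

  firstFault-sum : ∀ c m → sublistSum (placements k (c + m)) (firstFaultSummand (c + m) c) ≈ v a b k c *ᴿ h a b k m
  firstFault-sum c m = begin
    sublistSum L f
      ≈⟨ sublistSum-split (leftOf c) L f (firstFaultSummand-cong (c + m) c) ⟩
    sublistSum (filterᵇ (leftOf c) L) (λ s₁ → sublistSum U (λ u → f (s₁ ++ u)))
      ≡⟨ ≡.cong (λ l → sublistSum l (λ s₁ → sublistSum U (λ u → f (s₁ ++ u)))) (placements-leftOf c m) ⟩
    sublistSum (placements k c) (λ s₁ → sublistSum U (λ u → f (s₁ ++ u)))
      ≈⟨ sublistSum-cong-All (All-inside c) rightPart ⟩
    sublistSum (placements k c) (λ s₁ → sublistSum (placements k m) (λ s₃ → vSummand c s₁ *ᴿ hSummand m s₃))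
      ≈⟨ sublistSum-product (placements k c) (placements k m) (vSummand c) (hSummand m) ⟩
    sublistSum (placements k c) (vSummand c) *ᴿ sublistSum (placements k m) (hSummand m)
      ≈⟨ *-cong (v≈sublistSum c) (h≈sublistSum m) ⟨
    v a b k c *ᴿ h a b k m ∎
    where
    L U : List Tile
    L = placements k (c + m)
    U = filterᵇ (not ∘ leftOf c) L
    f : List Tile → Carrier
    f = firstFaultSummand (c + m) c
    crossing : All (λ x → ∀ s t → f (s ++ x ∷ t) ≈ 0#) (filterᵇ (not ∘ rightOf c) U)
    crossing = All.map (λ {x} (notRight , notLeft) s t → firstFaultSummand-vanish (c + m) c (s ++ x ∷ t)
        (vFault-crossing x (≤ᵇ-false⇒> (not-injective notRight)) (≤ᵇ-false⇒> (not-injective notLeft)) s t))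
      (All-filterᵇ-× (not ∘ rightOf c) (All-filterᵇ (not ∘ leftOf c) L))
    rightPart : ∀ s₁ → All (λ t → inside k c t ≡ true) s₁ →
                sublistSum U (λ u → f (s₁ ++ u)) ≈ sublistSum (placements k m) (λ s₃ → vSummand c s₁ *ᴿ hSummand m s₃)
    rightPart s₁ s₁-inside = begin
      sublistSum U (λ u → f (s₁ ++ u))
        ≈⟨ sublistSum-restrict (rightOf c) U (λ u → f (s₁ ++ u)) (firstFaultSummand-cong (c + m) c ∘ sameCounts-++ˡ s₁)
             (All.map (λ {x} kills s t → ≡.subst (λ l → f l ≈ 0#) (++-assoc s₁ s (x ∷ t)) (kills (s₁ ++ s) t)) crossing) ⟩
      sublistSum (filterᵇ (rightOf c) U) (λ u → f (s₁ ++ u))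
        ≡⟨ ≡.cong (λ l → sublistSum l (λ u → f (s₁ ++ u))) (≡.trans (filterᵇ-rightOf-notLeftOf c L) (placements-rightOf c m)) ⟩
      sublistSum (map (shift c) (placements k m)) (λ u → f (s₁ ++ u))
        ≈⟨ sublistSum-map (shift c) (placements k m) (λ u → f (s₁ ++ u)) ⟩
      sublistSum (placements k m) (λ s₃ → f (s₁ ++ map (shift c) s₃))
        ≈⟨ sublistSum-cong (placements k m) (λ s₃ → firstFaultSummand-split c m s₁ s₃ (All.map (λ {t} → inside⇒x₁≤ t) s₁-inside)) ⟩
      sublistSum (placements k m) (λ s₃ → vSummand c s₁ *ᴿ hSummand m s₃) ∎

  sublistSum-sumTo : ∀ (L : List Tile) n (F : ℕ → List Tile → Carrier) →
                     sublistSum L (λ s → sumTo n (λ i → F i s)) ≈ sumTo n (λ i → sublistSum L (F i))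
  sublistSum-sumTo L zero    F = sublistSum-zero L (λ _ → refl)
  sublistSum-sumTo L (suc n) F = trans (sublistSum-+ L _ _) (+-congʳ (sublistSum-sumTo L n F))

  -- The line x = n is always a vertical fault, so every tiling has exactly one leftmost one.
  hSummand-firstFault : ∀ m s → All (λ t → inside k (suc m) t ≡ true) s →
                        hSummand (suc m) s ≈ sumTo (suc m) (λ i → firstFaultSummand (suc m) (suc i) s)
  hSummand-firstFault m s s-inside = byCases (isTiling k (suc m) s) (hFault k k s)
    where
    rightEdge : vFault k (suc m) s ≡ true
    rightEdge = ≡.cong not (any-none (All.map (λ {t} e → meetsVLine-false-right t (inside⇒x₁≤ t e)) s-inside))
    byCases : ∀ t h → guard (t ∧ h) (w s) ≈
                      sumTo (suc m) (λ i → guard (t ∧ (h ∧ (vFault k (suc i) s ∧ vFaultFree k (suc i) s))) (w s))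
    byCases false h     = sym (sumTo-zero (suc m) (λ _ _ → refl))
    byCases true  false = sym (sumTo-zero (suc m) (λ _ _ → refl))
    byCases true  true  = sym (trans
      (sumTo-cong (suc m) (λ i _ → reflexive (≡.cong (λ b → guard (vFault k (suc i) s ∧ b) (w s)) (vFaultFree≡ (suc i) s))))
      (sumTo-firstTrue (λ d → vFault k d s) m (w s) rightEdge))

  h-suc : ∀ m → h a b k (suc m) ≈ sumTo (suc m) (λ i → v a b k (suc i) *ᴿ h a b k (m ∸ i))
  h-suc m = begin
    h a b k n
      ≈⟨ h≈sublistSum n ⟩
    sublistSum (placements k n) (hSummand n)
      ≈⟨ sublistSum-cong-All (All-inside n) (hSummand-firstFault m) ⟩
    sublistSum (placements k n) (λ s → sumTo n (λ i → firstFaultSummand n (suc i) s))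
      ≈⟨ sublistSum-sumTo (placements k n) n (λ i → firstFaultSummand n (suc i)) ⟩
    sumTo n (λ i → sublistSum (placements k n) (firstFaultSummand n (suc i)))
      ≈⟨ sumTo-cong n faultAt ⟩
    sumTo n (λ i → v a b k (suc i) *ᴿ h a b k (m ∸ i)) ∎
    where
    n : ℕ
    n = suc m
    faultAt : ∀ i → i < n → sublistSum (placements k n) (firstFaultSummand n (suc i)) ≈ v a b k (suc i) *ᴿ h a b k (n ∸ suc i)
    faultAt i i<n = ≡.subst (λ N → sublistSum (placements k N) (firstFaultSummand N (suc i)) ≈ v a b k (suc i) *ᴿ h a b k (n ∸ suc i))
                            (ℕₚ.m+[n∸m]≡n i<n) (firstFault-sum (suc i) (n ∸ suc i))

  H≈oneₛ+H⊛V : ∀ n → H a b k n ≈ oneₛ n +ᴿ (H a b k ⊛ V a b k) n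
  H≈oneₛ+H⊛V zero    = sym (trans (+-congˡ (trans (+-identityˡ _) (zeroʳ _))) (trans (+-identityʳ 1#) (sym h₀≈1)))
    where
    h₀≈1 : h a b k 0 ≈ 1#
    h₀≈1 = trans (+-identityʳ _) (*-identityˡ 1#)
  H≈oneₛ+H⊛V (suc m) = begin
    h a b k (suc m)
      ≈⟨ h-suc m ⟩
    sumTo (suc m) (λ i → V a b k (suc i) *ᴿ h a b k (m ∸ i))
      ≈⟨ trans (+-congʳ (zeroˡ _)) (+-identityˡ _) ⟨
    V a b k 0 *ᴿ h a b k (suc m) +ᴿ sumTo (suc m) (λ i → V a b k (suc i) *ᴿ h a b k (m ∸ i))
      ≈⟨ sumTo-first (suc m) (λ i → V a b k i *ᴿ h a b k (suc m ∸ i)) ⟨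
    (V a b k ⊛ H a b k) (suc m)
      ≈⟨ ⊛-comm (H a b k) (V a b k) (suc m) ⟨
    (H a b k ⊛ V a b k) (suc m)
      ≈⟨ +-identityˡ _ ⟨
    oneₛ (suc m) +ᴿ (H a b k ⊛ V a b k) (suc m) ∎

  hSummand-split : ∀ n s₁ s₃ → All (λ t → inStrip 0 t ≡ true) s₁ → All (λ t → inStrip k t ≡ true) s₃ →
                   hSummand n (s₁ ++ s₃) ≈ stripSummand 0 n s₁ *ᴿ stripSummand k n s₃
  hSummand-split n s₁ s₃ s₁-lower s₃-upper = begin
    hSummand n (s₁ ++ s₃)                       ≡⟨ ≡.cong₂ guard conditions ≡.refl ⟩
    guard (T₁ ∧ T₃) (w (s₁ ++ s₃))              ≈⟨ guard-cong _ (weight-++ s₁ s₃) ⟩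
    guard (T₁ ∧ T₃) (w s₁ *ᴿ w s₃)              ≈⟨ guard-∧ T₁ T₃ (w s₁) (w s₃) ⟩
    stripSummand 0 n s₁ *ᴿ stripSummand k n s₃  ∎
    where
    open HorizontalSplit n s₁ s₃ (All.map (λ {t} e → proj₂ (inStrip⇒ 0 t e)) s₁-lower)
                                 (All.map (λ {t} e → proj₁ (inStrip⇒ k t e)) s₃-upper)
    T₁ T₃ : Bool
    T₁ = tilesStrip 0 n s₁
    T₃ = tilesStrip k n s₃
    conditions : (isTiling k n (s₁ ++ s₃) ∧ hFault k k (s₁ ++ s₃)) ≡ (T₁ ∧ T₃)
    conditions = ≡.trans (≡.cong₂ _∧_ (≡.trans (isTiling≡ n (s₁ ++ s₃)) tilesRectangle-++) hFault-++) (∧-identityʳ _)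

  h≈stripWeight*stripWeight : ∀ n → h a b k n ≈ stripWeight 0 n *ᴿ stripWeight k n
  h≈stripWeight*stripWeight n = begin
    h a b k n
      ≈⟨ h≈sublistSum n ⟩
    sublistSum L f
      ≈⟨ sublistSum-split (inStrip 0) L f (hSummand-cong n) ⟩
    sublistSum (stripPlacements 0 n) (λ s₁ → sublistSum U (λ u → f (s₁ ++ u)))
      ≈⟨ sublistSum-cong-All (All-filterᵇ (inStrip 0) L) upperPart ⟩
    sublistSum (stripPlacements 0 n) (λ s₁ → sublistSum (stripPlacements k n) (λ s₃ → stripSummand 0 n s₁ *ᴿ stripSummand k n s₃))
      ≈⟨ sublistSum-product (stripPlacements 0 n) (stripPlacements k n) (stripSummand 0 n) (stripSummand k n) ⟩
    stripWeight 0 n *ᴿ stripWeight k n ∎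
    where
    L U : List Tile
    L = placements k n
    U = filterᵇ (not ∘ inStrip 0) L
    f : List Tile → Carrier
    f = hSummand n
    upper⇒notLower : filterᵇ (inStrip k) U ≡ stripPlacements k n
    upper⇒notLower = ≡.trans (filterᵇ-filterᵇ (inStrip k) (not ∘ inStrip 0) L) (filterᵇ-cong L notLower)
      where
      notLower : ∀ t → (not (inStrip 0 t) ∧ inStrip k t) ≡ inStrip k t
      notLower t with inStrip k t in e
      ... | false = ∧-zeroʳ _
      ... | true  = ≡.trans (∧-identityʳ _) (≡.cong not (≤ᵇ-false {y₁ t} {k} (ℕₚ.≤-<-trans (proj₁ (inStrip⇒ k t e)) (y₀<y₁ t))))
    y₀<k : ∀ t → inStrip k t ≡ false → y₁ t ≤ k + k → y₀ t < k
    y₀<k t notUpper y₁≤2k with k ≤ᵇ y₀ t in e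
    ... | false = ≤ᵇ-false⇒> e
    ... | true rewrite ≤ᵇ-true y₁≤2k = case notUpper of λ ()
    crossing : All (λ x → ∀ s t → f (s ++ x ∷ t) ≈ 0#) (filterᵇ (not ∘ inStrip k) U)
    crossing = All.map (λ {x} (notUpper , notLower , x-inside) s t → hSummand-vanish n (s ++ x ∷ t)
        (hFault-crossing x (y₀<k x (not-injective notUpper) (inside⇒y₁≤ x x-inside)) (≤ᵇ-false⇒> (not-injective notLower)) s t))
      (All-filterᵇ-× (not ∘ inStrip k) (All-filterᵇ-× (not ∘ inStrip 0) (All-inside n)))
    upperPart : ∀ s₁ → All (λ t → inStrip 0 t ≡ true) s₁ →
      sublistSum U (λ u → f (s₁ ++ u)) ≈ sublistSum (stripPlacements k n) (λ s₃ → stripSummand 0 n s₁ *ᴿ stripSummand k n s₃)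
    upperPart s₁ s₁-lower = begin
      sublistSum U (λ u → f (s₁ ++ u))
        ≈⟨ sublistSum-restrict (inStrip k) U (λ u → f (s₁ ++ u)) (hSummand-cong n ∘ sameCounts-++ˡ s₁)
             (All.map (λ {x} kills s t → ≡.subst (λ l → f l ≈ 0#) (++-assoc s₁ s (x ∷ t)) (kills (s₁ ++ s) t)) crossing) ⟩
      sublistSum (filterᵇ (inStrip k) U) (λ u → f (s₁ ++ u))
        ≡⟨ ≡.cong (λ l → sublistSum l (λ u → f (s₁ ++ u))) upper⇒notLower ⟩
      sublistSum (stripPlacements k n) (λ s₃ → f (s₁ ++ s₃))
        ≈⟨ sublistSum-cong-All (All-filterᵇ (inStrip k) L) (λ s₃ s₃-upper → hSummand-split n s₁ s₃ s₁-lower s₃-upper) ⟩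
      sublistSum (stripPlacements k n) (λ s₃ → stripSummand 0 n s₁ *ᴿ stripSummand k n s₃) ∎

  module _ (r : ℕ) where

    laterColumns : ℕ → List Tile
    laterColumns n = filterᵇ (rightOf 1) (stripPlacements r n)

    All-laterColumns : ∀ n → All (λ t → 1 ≤ x₀ t) (laterColumns n)
    All-laterColumns n = All.map ≤ᵇ-true⇒≤ (All-filterᵇ (rightOf 1) (stripPlacements r n))

    stripWeight-verticalFirst : ∀ m →
      sublistSum (laterColumns (suc m)) (λ s → stripSummand r (suc m) (s ++ vert 0 r ∷ [])) ≈ a *ᴿ stripWeight r m
    stripWeight-verticalFirst m = begin
      sublistSum (laterColumns (1 + m)) F
        ≡⟨ ≡.cong (λ l → sublistSum l F) (stripPlacements-rightOf r 1 m) ⟩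
      sublistSum (map (shift 1) (stripPlacements r m)) F
        ≈⟨ sublistSum-map (shift 1) (stripPlacements r m) F ⟩
      sublistSum (stripPlacements r m) (λ s → F (map (shift 1) s))
        ≈⟨ sublistSum-cong (stripPlacements r m) shifted ⟩
      sublistSum (stripPlacements r m) (λ s → a *ᴿ stripSummand r m s)
        ≈⟨ sublistSum-*ˡ (stripPlacements r m) a (stripSummand r m) ⟩
      a *ᴿ stripWeight r m ∎
      where
      open VerticalFirst r m
      F : List Tile → Carrier
      F s = stripSummand r (suc m) (s ++ vert 0 r ∷ [])
      shifted : ∀ s → F (map (shift 1) s) ≈ a *ᴿ stripSummand r m s
      shifted s = begin
        guard (tilesStrip r (suc m) (S s)) (w (S s))  ≡⟨ ≡.cong₂ guard (tilesStrip-S s) ≡.refl ⟩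
        guard (tilesStrip r m s) (w (S s))            ≈⟨ guard-cong _ (trans (weight-++ (map (shift 1) s) _)
                                                          (trans (*-cong (reflexive (weight-shift 1 s)) (weight-vertical 0 r)) (*-comm _ _))) ⟩
        guard (tilesStrip r m s) (a *ᴿ w s)           ≈⟨ guard-*ˡ _ a (w s) ⟩
        a *ᴿ stripSummand r m s                       ∎

    stripWeight-horizontalFirst : ∀ m →
      sublistSum (laterColumns (k + m)) (λ s → stripSummand r (k + m) (s ++ horizontalStack r k)) ≈ pow b k *ᴿ stripWeight r m
    stripWeight-horizontalFirst m = begin
      sublistSum (laterColumns N) F
        ≈⟨ sublistSum-restrict (rightOf k) (laterColumns N) F (λ s∼s′ → stripSummand-cong r N (sameCounts-++ s∼s′ sameCounts-refl))
                               overlapping ⟩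
      sublistSum (filterᵇ (rightOf k) (laterColumns N)) F
        ≡⟨ ≡.cong (λ l → sublistSum l F) (≡.trans rightOf-k (stripPlacements-rightOf r k m)) ⟩
      sublistSum (map (shift k) (stripPlacements r m)) F
        ≈⟨ sublistSum-map (shift k) (stripPlacements r m) F ⟩
      sublistSum (stripPlacements r m) (λ s → F (map (shift k) s))
        ≈⟨ sublistSum-cong (stripPlacements r m) shifted ⟩
      sublistSum (stripPlacements r m) (λ s → pow b k *ᴿ stripSummand r m s)
        ≈⟨ sublistSum-*ˡ (stripPlacements r m) (pow b k) (stripSummand r m) ⟩
      pow b k *ᴿ stripWeight r m ∎
      where
      open HorizontalFirst r m
      N : ℕ
      N = k + m
      F : List Tile → Carrier
      F s = stripSummand r N (s ++ horizontalStack r k)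
      rightOf-k : filterᵇ (rightOf k) (laterColumns N) ≡ filterᵇ (rightOf k) (stripPlacements r N)
      rightOf-k = ≡.trans (filterᵇ-filterᵇ (rightOf k) (rightOf 1) (stripPlacements r N)) (filterᵇ-cong (stripPlacements r N) implied)
        where
        implied : ∀ t → (rightOf 1 t ∧ rightOf k t) ≡ rightOf k t
        implied t with rightOf k t in e
        ... | false = ∧-zeroʳ _
        ... | true  = ≡.trans (∧-identityʳ _) (≤ᵇ-true (ℕₚ.≤-trans 1≤k (≤ᵇ-true⇒≤ {k} e)))
      overlapping : All (λ x → ∀ s t → F (s ++ x ∷ t) ≈ 0#) (filterᵇ (not ∘ rightOf k) (laterColumns N))
      overlapping = All.map (λ {x} (notRight , x-in) s t →
          guard-false _ (stack-blocks-x₀<k x (≤ᵇ-false⇒> (not-injective notRight)) x-in s t))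
        (All-filterᵇ-× (not ∘ rightOf k) (All-filterᵇ⁺ (rightOf 1) (All-filterᵇ (inStrip r) (placements k N))))
      shifted : ∀ s → F (map (shift k) s) ≈ pow b k *ᴿ stripSummand r m s
      shifted s = begin
        guard (tilesStrip r N (S s)) (w (S s))        ≡⟨ ≡.cong₂ guard (tilesStrip-S s) ≡.refl ⟩
        guard (tilesStrip r m s) (w (S s))            ≈⟨ guard-cong _ (trans (weight-++ (map (shift k) s) _)
                                                          (trans (*-cong (reflexive (weight-shift k s)) (weight-horizontalStack r)) (*-comm _ _))) ⟩
        guard (tilesStrip r m s) (pow b k *ᴿ w s)     ≈⟨ guard-*ˡ _ (pow b k) (w s) ⟩
        pow b k *ᴿ stripSummand r m s                 ∎

    sublistSum-horizontalStack : ∀ j (F : List Tile → Carrier) →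
      (∀ j′ → j′ < j → ∀ t → count (covers k 0 (r + j′)) t ≡ 0 → F t ≈ 0#) →
      sublistSum (horizontalStack r j) F ≈ F (horizontalStack r j)
    sublistSum-horizontalStack zero    F uncovered⇒0 = sublistSum-[] F
    sublistSum-horizontalStack (suc j) F uncovered⇒0 = begin
      sublistSum (Stack ++ x ∷ []) F
        ≈⟨ sublistSum-++ Stack (x ∷ []) F ⟩
      sublistSum Stack (λ s → sublistSum (x ∷ []) (λ t → F (s ++ t)))
        ≈⟨ sublistSum-cong Stack (λ s → trans (sublistSum-∷ x [] (λ t → F (s ++ t)))
             (+-cong (sublistSum-[] (λ t → F (s ++ x ∷ t))) (sublistSum-[] (λ t → F (s ++ t))))) ⟩
      sublistSum Stack (λ s → F (s ++ x ∷ []) +ᴿ F (s ++ []))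
        ≈⟨ sublistSum-+ Stack _ _ ⟩
      sublistSum Stack (λ s → F (s ++ x ∷ [])) +ᴿ sublistSum Stack (λ s → F (s ++ []))
        ≈⟨ +-cong with-x without-x ⟩
      F (Stack ++ x ∷ []) +ᴿ 0#
        ≈⟨ +-identityʳ _ ⟩
      F (horizontalStack r (suc j)) ∎
      where
      Stack : List Tile
      Stack = horizontalStack r j
      x : Tile
      x = horiz 0 (r + j)
      with-x : sublistSum Stack (λ s → F (s ++ x ∷ [])) ≈ F (Stack ++ x ∷ [])
      with-x = sublistSum-horizontalStack j (λ t → F (t ++ x ∷ [])) (λ j′ j′<j t t-misses →
        uncovered⇒0 j′ (ℕₚ.m<n⇒m<1+n j′<j) (t ++ x ∷ []) (≡.trans (count-++ (covers k 0 (r + j′)) t (x ∷ []))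
          (≡.cong₂ _+_ t-misses (≡.cong (λ b → if b then 1 else 0) (covers-false-below {0} {r + j′} x (ℕₚ.+-monoʳ-< r j′<j))))))
      without-x : sublistSum Stack (λ s → F (s ++ [])) ≈ 0#
      without-x = sublistSum-zero-All (All-IsStackTile r j) (λ s s-stack →
        uncovered⇒0 j (ℕₚ.n<1+n j) (s ++ []) (≡.trans (count-++ (covers k 0 (r + j)) s []) (≡.trans (ℕₚ.+-identityʳ _)
          (count-none (All.map (λ {t} (_ , _ , _ , _ , y₀<r+j , y₁≡1+y₀) →
            covers-false-above t (≡.subst (_≤ r + j) (≡.sym y₁≡1+y₀) y₀<r+j)) s-stack)))))

    firstColumnStack : ℕ → List Tile
    firstColumnStack m = if k ≤ᵇ suc m then horizontalStack r k else []

    stripWeight-stackFirst : ∀ m →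
      sublistSum (laterColumns (suc m)) (λ s → sublistSum (firstColumnStack m) (λ u → stripSummand r (suc m) (s ++ u))) ≈
      guard (k ≤ᵇ suc m) (pow b k *ᴿ stripWeight r (suc m ∸ k))
    stripWeight-stackFirst m with k ≤ᵇ suc m in fits
    ... | false = sublistSum-zero-All (All-laterColumns (suc m)) (λ s s-later →
        trans (sublistSum-[] (λ u → stripSummand r (suc m) (s ++ u)))
              (guard-false (w (s ++ [])) (first-column-uncovered r m s [] 0 s-later 1≤k ≡.refl)))
    ... | true = begin
      sublistSum (laterColumns (suc m)) (λ s → sublistSum (horizontalStack r k) (λ u → stripSummand r (suc m) (s ++ u)))
        ≈⟨ sublistSum-cong-All (All-laterColumns (suc m)) (λ s s-later →
             sublistSum-horizontalStack k (λ u → stripSummand r (suc m) (s ++ u)) (λ j j<k t t-misses →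
               guard-false _ (first-column-uncovered r m s t j s-later j<k t-misses))) ⟩
      sublistSum (laterColumns (suc m)) (λ s → stripSummand r (suc m) (s ++ horizontalStack r k))
        ≡⟨ ≡.cong (λ N → sublistSum (laterColumns N) (λ s → stripSummand r N (s ++ horizontalStack r k)))
                  (≡.sym (ℕₚ.m+[n∸m]≡n (≤ᵇ-true⇒≤ {k} {suc m} fits))) ⟩
      sublistSum (laterColumns (k + (suc m ∸ k))) (λ s → stripSummand r (k + (suc m ∸ k)) (s ++ horizontalStack r k))
        ≈⟨ stripWeight-horizontalFirst (suc m ∸ k) ⟩
      pow b k *ᴿ stripWeight r (suc m ∸ k) ∎

    -- Column 0 of the strip is covered either by the vertical tile at height r or by a full stack of k horizontals.
    stripSummand-firstColumn : r ≤ k → ∀ m s →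
      sublistSum (firstColumn r m) (λ u → stripSummand r (suc m) (s ++ u)) ≈
      stripSummand r (suc m) (s ++ vert 0 r ∷ []) +ᴿ sublistSum (firstColumnStack m) (λ u → stripSummand r (suc m) (s ++ u))
    stripSummand-firstColumn r≤k m s = begin
      sublistSum (firstColumn r m) (λ u → f (s ++ u))
        ≈⟨ sublistSum-split isVert (firstColumn r m) (λ u → f (s ++ u)) (stripSummand-cong r (suc m) ∘ sameCounts-++ˡ s) ⟩
      sublistSum (filterᵇ isVert (firstColumn r m)) (λ u → sublistSum (filterᵇ (not ∘ isVert) (firstColumn r m)) (λ u′ → f (s ++ (u ++ u′))))
        ≡⟨ ≡.cong₂ (λ Vs Hs → sublistSum Vs (λ u → sublistSum Hs (λ u′ → f (s ++ (u ++ u′)))))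
                   (firstColumn-vertical r m r≤k) (firstColumn-horizontal r m r≤k) ⟩
      sublistSum (vert 0 r ∷ []) (λ u → sublistSum Stack (λ u′ → f (s ++ (u ++ u′))))
        ≈⟨ trans (sublistSum-∷ (vert 0 r) [] (λ u → sublistSum Stack (λ u′ → f (s ++ (u ++ u′)))))
                 (+-cong (sublistSum-[] (λ u → sublistSum Stack (λ u′ → f (s ++ (vert 0 r ∷ u ++ u′)))))
                         (sublistSum-[] (λ u → sublistSum Stack (λ u′ → f (s ++ (u ++ u′)))))) ⟩
      sublistSum Stack (λ u′ → f (s ++ vert 0 r ∷ u′)) +ᴿ sublistSum Stack (λ u′ → f (s ++ u′))
        ≈⟨ +-congʳ (sublistSum-only-[] (All.map (λ x-stack t →
             guard-false _ (VerticalFirst.vertical-blocks-stack r m _ x-stack s t)) stackTiles)) ⟩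
      f (s ++ vert 0 r ∷ []) +ᴿ sublistSum Stack (λ u′ → f (s ++ u′)) ∎
      where
      f : List Tile → Carrier
      f = stripSummand r (suc m)
      Stack : List Tile
      Stack = firstColumnStack m
      stackTiles : All (IsStackTile r k) Stack
      stackTiles with k ≤ᵇ suc m
      ... | true  = All-IsStackTile r k
      ... | false = []

    stripWeight-recurrence : r ≤ k → SatisfiesRecurrence k a (pow b k) (stripWeight r)
    stripWeight-recurrence r≤k = trans (+-identityʳ _) (*-identityˡ 1#) , step
      where
      step : ∀ m → stripWeight r (suc m) ≈ a *ᴿ stripWeight r m +ᴿ guard (k ≤ᵇ suc m) (pow b k *ᴿ stripWeight r (suc m ∸ k))
      step m = begin
        stripWeight r (suc m)
          ≈⟨ sublistSum-split (rightOf 1) (stripPlacements r (suc m)) f (stripSummand-cong r (suc m)) ⟩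
        sublistSum (laterColumns (suc m)) (λ s → sublistSum (firstColumn r m) (λ u → f (s ++ u)))
          ≈⟨ sublistSum-cong (laterColumns (suc m)) (stripSummand-firstColumn r≤k m) ⟩
        sublistSum (laterColumns (suc m)) (λ s → f (s ++ vert 0 r ∷ []) +ᴿ sublistSum (firstColumnStack m) (λ u → f (s ++ u)))
          ≈⟨ sublistSum-+ (laterColumns (suc m)) _ _ ⟩
        sublistSum (laterColumns (suc m)) (λ s → f (s ++ vert 0 r ∷ [])) +ᴿ
        sublistSum (laterColumns (suc m)) (λ s → sublistSum (firstColumnStack m) (λ u → f (s ++ u)))
          ≈⟨ +-cong (stripWeight-verticalFirst m) (stripWeight-stackFirst m) ⟩
        a *ᴿ stripWeight r m +ᴿ guard (k ≤ᵇ suc m) (pow b k *ᴿ stripWeight r (suc m ∸ k)) ∎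
        where
        f : List Tile → Carrier
        f = stripSummand r (suc m)

proposition2p1 : ∀ {c ℓ} (R : CommutativeRing c ℓ) (k : ℕ) → 2 ≤ k →
    (a b : CommutativeRing.Carrier R) →
    let open WithRing R in
      ((H a b k ⊛ (oneₛ −ₛ V a b k)) ≈ₛ oneₛ)
      × (∀ (G : Series) → (p k a (pow b k) ⊛ G) ≈ₛ oneₛ → H a b k ≈ₛ (G ⊙ G))
proposition2p1 R k 2≤k a b = H⊛[1−V]≈1 , H≈G⊙G
  where
  open CommutativeRing R using (trans; *-cong; +-congʳ)
  open WithRing R
  open SeriesAlgebra R

  1≤k : 1 ≤ k
  1≤k = ℕₚ.≤-trans (s≤s z≤n) 2≤k

  open TilingSums R k 1≤k a b

  H⊛[1−V]≈1 : (H a b k ⊛ (oneₛ −ₛ V a b k)) ≈ₛ oneₛ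
  H⊛[1−V]≈1 n = trans (⊛-−ₛ (H a b k) oneₛ (V a b k) n)
                      (trans (+-congʳ (⊛-oneₛ (H a b k) n)) (x≈y+z⇒x-z≈y (H≈oneₛ+H⊛V n)))

  H≈G⊙G : ∀ G → (p k a (pow b k) ⊛ G) ≈ₛ oneₛ → H a b k ≈ₛ (G ⊙ G)
  H≈G⊙G G pG≈1 n = trans (h≈stripWeight*stripWeight n) (*-cong (stripWeight≈G 0 z≤n n) (stripWeight≈G k ℕₚ.≤-refl n))
    where
    stripWeight≈G : ∀ r → r ≤ k → stripWeight r ≈ₛ G
    stripWeight≈G r r≤k =
      satisfiesRecurrence-unique 1≤k (stripWeight-recurrence r r≤k) (inverse-satisfiesRecurrence G 1≤k pG≈1)
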